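{- Let $p$ be a prime and let $n,m,N\in\mathbb{N}$ with $0<n\le m<N/3$. Then $n\mid_p m$ if and only if there exists $\alpha\in\mathbb{F}_p[t]/(t^N)$ such that $\alpha^p(t^n-t^m)=t^nt^m(1-\alpha^{p-1})$ and $\alpha^{3p}\neq 0$ in $\mathbb{F}_p[t]/(t^N)$.
   Context: For $n,m\in\mathbb{N}$, $n\mid_p m$ means that $m=p^s n$ for some $s\in\mathbb{N}$ (with $s=0$ allowed). -}

module Defs where

open import Data.Nat as ℕ using (ℕ; zero; suc; _∸_; _<_)
open import Data.Nat.Properties using (_≟_)
open import Data.Integer as ℤ using (ℤ; +_)
open import Data.Integer.Divisibility as ℤD using ()
open import Data.Product using (∃)
open import Relation.Binary.PropositionalEquality using (_≡_)
open import Relation.Nullary using (yes; no)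

_∣[_]_ : ℕ → ℕ → ℕ → Set
n ∣[ p ] m = ∃ λ (s : ℕ) → m ≡ p ℕ.^ s ℕ.* n

-- Model of F_p[t]/(t^N): an element is represented by a coefficient
-- sequence ℕ → ℤ; two representatives are equal in F_p[t]/(t^N) iff
-- their coefficients of t^i agree modulo p for all i < N.
Poly : Set
Poly = ℕ → ℤ

Eq : (p N : ℕ) → Poly → Poly → Set
Eq p N a b = ∀ (i : ℕ) → i < N → (+ p) ℤD.∣ (a i ℤ.- b i)

sumTo : ℕ → (ℕ → ℤ) → ℤ
sumTo zero f = f 0
sumTo (suc k) f = sumTo k f ℤ.+ f (suc k)

_⊕_ : Poly → Poly → Poly
(a ⊕ b) i = a i ℤ.+ b i

_⊖_ : Poly → Poly → Poly
(a ⊖ b) i = a i ℤ.- b i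

_⊛_ : Poly → Poly → Poly
(a ⊛ b) k = sumTo k (λ i → a i ℤ.* b (k ∸ i))

infixl 6 _⊕_ _⊖_
infixl 7 _⊛_

tpow : ℕ → Poly
tpow n i with i ≟ n
... | yes _ = + 1
... | no _ = + 0

one : Poly
one = tpow 0

zeroP : Poly
zeroP _ = + 0

_^ᴾ_ : Poly → ℕ → Poly
a ^ᴾ zero = one
a ^ᴾ suc k = a ⊛ (a ^ᴾ k)
infixr 8 _^ᴾ_

-- Given a solution α, let k be the t-adic valuation of α modulo p, α = t^k u with u₀ ≢ 0, and δ = m − n.
-- The equation becomes t^(pk+n) u^p (1 − t^δ) = t^(n+m) (1 − t^((p−1)k) u^(p−1)); comparing the
-- lowest coefficients forces pk = m (when n ≠ m). Cancelling t^(n+m), the inverse w of u solves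
-- w^p − t^((p−1)k) w = 1 − t^δ modulo t^(N−n−m), and w^p = Σ w_j^p t^(pj) in characteristic p.
-- Reading off the coefficient of t^(m−ρ) shows that w_(k−ρ) ≢ 0 forces p ∣ ρ and w_(k−ρ/p) ≢ 0
-- unless ρ = n; descending from ρ = k (where w₀ ≢ 0) yields k = p^s n, hence m = p^(s+1) n.
--
-- Conversely, for m = n take α = 1, and for m = p^(s+1) n the polynomials g₀ = 1,
-- g_(s+1) = 1 + t^((p−1)p^s n) g_s satisfy g_s^p − t^((p−1)p^s n) g_s = 1 − t^(m−n) by the
-- freshman's dream, and α = t^(p^s n) / g_s works.

module Submission where

open import Defs
open import Algebra.Bundles using (CommutativeRing; CommutativeSemiring)
open import Algebra.Structures using (IsCommutativeRing)
open import Algebra.Solver.Ring.AlmostCommutativeRing using (fromCommutativeRing; _-Raw-AlmostCommutative⟶_)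
open import Data.Integer as ℤ using (ℤ; +_)
import Data.Integer.Properties as ℤ
open import Data.Integer.Divisibility.Signed as ℤ∣ using (∣m∣n⇒∣m+n; ∣m⇒∣-m; ∣m⇒∣m*n; ∣ᵤ⇒∣; ∣⇒∣ᵤ)
open import Data.Integer.Tactic.RingSolver as ℤ-Solver using ()
open import Data.Nat.Tactic.RingSolver as ℕ-Solver using ()
open import Data.Nat
  using (ℕ; zero; suc; _+_; _*_; _∸_; _^_; _<_; _≤_; z≤n; s≤s; z<s; s<s; s≤s⁻¹; s<s⁻¹; NonZero; >-nonZero; _!; nonTrivial⇒n>1)
open import Data.Nat.Properties
open import Data.Nat.Induction using (<-rec)
open import Data.Nat.Combinatorics using (_C_; nCk≡n!/k![n-k]!; k![n∸k]!∣n!; nCn≡1)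
open import Data.Nat.Divisibility using (_∣_; _∣?_; divides; ∣m+n∣m⇒∣n; ∣1⇒≡1; ∣⇒≤; m∣m*n)
open import Data.Nat.DivMod using (_/_; m/n*n≡m)
open import Data.Nat.Primality using (Prime; prime⇒nonTrivial; prime⇒nonZero; euclidsLemma)
open import Data.Sum using (_⊎_; inj₁; inj₂; [_,_]′)
open import Relation.Nullary using (¬_; contradiction; Dec; yes; no)
open import Relation.Binary.Definitions using (Tri; tri<; tri≈; tri>)
open import Data.Product using (_,_; _×_; ∃; proj₁; proj₂)
open import Data.Maybe using (Maybe; just; nothing)
open import Data.Fin as Fin using (Fin; toℕ; fromℕ)
open import Data.Fin.Properties using (toℕ-fromℕ)
open import Function using (_∘_; _⇔_; mk⇔; Equivalence)
open import Relation.Binary.PropositionalEquality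
  using (_≡_; _≢_; ≢-sym; refl; sym; trans; cong; cong₂; subst; _≗_; module ≡-Reasoning)
import Relation.Binary.Reasoning.Setoid

-- Finite sums and the Cauchy product

sumTo-cong : ∀ k {f g : ℕ → ℤ} → (∀ i → i ≤ k → f i ≡ g i) → sumTo k f ≡ sumTo k g
sumTo-cong zero     f≡g = f≡g 0 z≤n
sumTo-cong (suc k)  f≡g =
  cong₂ ℤ._+_ (sumTo-cong k (λ i i≤k → f≡g i (m≤n⇒m≤1+n i≤k))) (f≡g (suc k) ≤-refl)

sumTo-suc : ∀ k f → sumTo (suc k) f ≡ f 0 ℤ.+ sumTo k (f ∘ suc)
sumTo-suc zero    f = refl
sumTo-suc (suc k) f = begin
  sumTo (suc k) f ℤ.+ f (suc (suc k))                 ≡⟨ cong (ℤ._+ f (suc (suc k))) (sumTo-suc k f) ⟩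
  (f 0 ℤ.+ sumTo k (f ∘ suc)) ℤ.+ f (suc (suc k))     ≡⟨ ℤ.+-assoc (f 0) _ _ ⟩
  f 0 ℤ.+ (sumTo k (f ∘ suc) ℤ.+ f (suc (suc k)))     ∎
  where open ≡-Reasoning

sumTo-+ : ∀ k f g → sumTo k (λ i → f i ℤ.+ g i) ≡ sumTo k f ℤ.+ sumTo k g
sumTo-+ zero    f g = refl
sumTo-+ (suc k) f g rewrite sumTo-+ k f g = middle-swap (sumTo k f) (sumTo k g) (f (suc k)) (g (suc k))
  where
  middle-swap : ∀ a b c d → (a ℤ.+ b) ℤ.+ (c ℤ.+ d) ≡ (a ℤ.+ c) ℤ.+ (b ℤ.+ d)
  middle-swap = ℤ-Solver.solve-∀

sumTo-*ˡ : ∀ k s f → sumTo k (λ i → s ℤ.* f i) ≡ s ℤ.* sumTo k f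
sumTo-*ˡ zero    s f = refl
sumTo-*ˡ (suc k) s f rewrite sumTo-*ˡ k s f = sym (ℤ.*-distribˡ-+ s _ _)

sumTo-neg : ∀ k f → sumTo k (λ i → ℤ.- f i) ≡ ℤ.- sumTo k f
sumTo-neg zero    f = refl
sumTo-neg (suc k) f rewrite sumTo-neg k f = sym (ℤ.neg-distrib-+ (sumTo k f) (f (suc k)))

sumTo-zero : ∀ k → sumTo k (λ _ → + 0) ≡ + 0
sumTo-zero zero    = refl
sumTo-zero (suc k) rewrite sumTo-zero k = refl

sumTo-reverse : ∀ k f → sumTo k f ≡ sumTo k (λ i → f (k ∸ i))
sumTo-reverse zero    f = refl
sumTo-reverse (suc k) f = begin
  sumTo (suc k) f                              ≡⟨ sumTo-suc k f ⟩
  f 0 ℤ.+ sumTo k (f ∘ suc)                    ≡⟨ cong (λ z → f 0 ℤ.+ z) (sumTo-reverse k (f ∘ suc)) ⟩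
  f 0 ℤ.+ sumTo k (λ i → f (suc (k ∸ i)))
    ≡⟨ cong (λ z → f 0 ℤ.+ z) (sumTo-cong k (λ i i≤k → cong f (sym (+-∸-assoc 1 i≤k)))) ⟩
  f 0 ℤ.+ sumTo k (λ i → f (suc k ∸ i))        ≡⟨ ℤ.+-comm (f 0) _ ⟩
  sumTo k (λ i → f (suc k ∸ i)) ℤ.+ f 0
    ≡⟨ cong (λ j → sumTo k (λ i → f (suc k ∸ i)) ℤ.+ f j) (sym (n∸n≡0 (suc k))) ⟩
  sumTo (suc k) (λ i → f (suc k ∸ i))          ∎
  where open ≡-Reasoning

drop : ℕ → Poly → Poly
drop k a i = a (k + i)

infixr 7 _•_
_•_ : ℤ → Poly → Poly
(s • a) i = s ℤ.* a i

infix 8 ⊝_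
⊝_ : Poly → Poly
(⊝ a) i = ℤ.- a i

⊛-suc : ∀ a b k → (a ⊛ b) (suc k) ≡ a 0 ℤ.* b (suc k) ℤ.+ (drop 1 a ⊛ b) k
⊛-suc a b k = sumTo-suc k (λ i → a i ℤ.* b (suc k ∸ i))

⊛-congʳ-≗ : ∀ b {a a′} → a ≗ a′ → a ⊛ b ≗ a′ ⊛ b
⊛-congʳ-≗ b a≗a′ k = sumTo-cong k (λ i _ → cong (ℤ._* b (k ∸ i)) (a≗a′ i))

⊛-congˡ-≗ : ∀ a {b b′} → b ≗ b′ → a ⊛ b ≗ a ⊛ b′
⊛-congˡ-≗ a b≗b′ k = sumTo-cong k (λ i _ → cong (a i ℤ.*_) (b≗b′ (k ∸ i)))

⊛-comm : ∀ a b → a ⊛ b ≗ b ⊛ a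
⊛-comm a b k = begin
  sumTo k (λ i → a i ℤ.* b (k ∸ i))                  ≡⟨ sumTo-reverse k _ ⟩
  sumTo k (λ i → a (k ∸ i) ℤ.* b (k ∸ (k ∸ i)))      ≡⟨ sumTo-cong k swap ⟩
  sumTo k (λ i → b i ℤ.* a (k ∸ i))                  ∎
  where
  open ≡-Reasoning
  swap : ∀ i → i ≤ k → a (k ∸ i) ℤ.* b (k ∸ (k ∸ i)) ≡ b i ℤ.* a (k ∸ i)
  swap i i≤k rewrite m∸[m∸n]≡n i≤k = ℤ.*-comm (a (k ∸ i)) (b i)

⊛-distribʳ : ∀ a b c → (a ⊕ b) ⊛ c ≗ a ⊛ c ⊕ b ⊛ c
⊛-distribʳ a b c k =
  trans (sumTo-cong k (λ i _ → ℤ.*-distribʳ-+ (c (k ∸ i)) (a i) (b i))) (sumTo-+ k _ _)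

⊛-distribˡ : ∀ a b c → a ⊛ (b ⊕ c) ≗ a ⊛ b ⊕ a ⊛ c
⊛-distribˡ a b c k =
  trans (sumTo-cong k (λ i _ → ℤ.*-distribˡ-+ (a i) (b (k ∸ i)) (c (k ∸ i)))) (sumTo-+ k _ _)

•-⊛ : ∀ s a b → (s • a) ⊛ b ≗ s • (a ⊛ b)
•-⊛ s a b k = trans (sumTo-cong k (λ i _ → ℤ.*-assoc s (a i) _)) (sumTo-*ˡ k s _)

⊛-• : ∀ a s b → a ⊛ (s • b) ≗ s • (a ⊛ b)
⊛-• a s b k = begin
  (a ⊛ (s • b)) k   ≡⟨ ⊛-comm a (s • b) k ⟩
  ((s • b) ⊛ a) k   ≡⟨ •-⊛ s b a k ⟩
  s ℤ.* (b ⊛ a) k   ≡⟨ cong (s ℤ.*_) (⊛-comm b a k) ⟩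
  s ℤ.* (a ⊛ b) k   ∎
  where open ≡-Reasoning

⊝-⊛ : ∀ a b → (⊝ a) ⊛ b ≗ ⊝ (a ⊛ b)
⊝-⊛ a b k = trans (sumTo-cong k (λ i _ → sym (ℤ.neg-distribˡ-* (a i) _))) (sumTo-neg k _)

⊛-zeroˡ : ∀ b → zeroP ⊛ b ≗ zeroP
⊛-zeroˡ b k = trans (sumTo-cong k (λ i _ → ℤ.*-zeroˡ (b (k ∸ i)))) (sumTo-zero k)

⊛-identityˡ : ∀ b → one ⊛ b ≗ b
⊛-identityˡ b zero    = ℤ.*-identityˡ (b 0)
⊛-identityˡ b (suc k) = begin
  (one ⊛ b) (suc k)                          ≡⟨ ⊛-suc one b k ⟩
  + 1 ℤ.* b (suc k) ℤ.+ (drop 1 one ⊛ b) k   ≡⟨ cong₂ ℤ._+_ (ℤ.*-identityˡ (b (suc k))) (⊛-zeroˡ b k) ⟩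
  b (suc k) ℤ.+ + 0                          ≡⟨ ℤ.+-identityʳ (b (suc k)) ⟩
  b (suc k)                                  ∎
  where open ≡-Reasoning

⊛-assoc : ∀ a b c → (a ⊛ b) ⊛ c ≗ a ⊛ (b ⊛ c)
⊛-assoc a b c zero    = ℤ.*-assoc (a 0) (b 0) (c 0)
⊛-assoc a b c (suc k) = begin
  ((a ⊛ b) ⊛ c) (suc k)
    ≡⟨ ⊛-suc (a ⊛ b) c k ⟩
  a 0 ℤ.* b 0 ℤ.* c (suc k) ℤ.+ (drop 1 (a ⊛ b) ⊛ c) k
    ≡⟨ cong (λ z → a 0 ℤ.* b 0 ℤ.* c (suc k) ℤ.+ z) (⊛-congʳ-≗ c (⊛-suc a b) k) ⟩
  a 0 ℤ.* b 0 ℤ.* c (suc k) ℤ.+ ((a 0 • drop 1 b ⊕ drop 1 a ⊛ b) ⊛ c) k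
    ≡⟨ cong (λ z → a 0 ℤ.* b 0 ℤ.* c (suc k) ℤ.+ z) (⊛-distribʳ (a 0 • drop 1 b) (drop 1 a ⊛ b) c k) ⟩
  a 0 ℤ.* b 0 ℤ.* c (suc k) ℤ.+ (((a 0 • drop 1 b) ⊛ c) k ℤ.+ ((drop 1 a ⊛ b) ⊛ c) k)
    ≡⟨ cong (λ z → a 0 ℤ.* b 0 ℤ.* c (suc k) ℤ.+ z)
            (cong₂ ℤ._+_ (•-⊛ (a 0) (drop 1 b) c k) (⊛-assoc (drop 1 a) b c k)) ⟩
  a 0 ℤ.* b 0 ℤ.* c (suc k) ℤ.+ (a 0 ℤ.* (drop 1 b ⊛ c) k ℤ.+ (drop 1 a ⊛ (b ⊛ c)) k)
    ≡⟨ regroup (a 0) (b 0) (c (suc k)) ((drop 1 b ⊛ c) k) ((drop 1 a ⊛ (b ⊛ c)) k) ⟩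
  a 0 ℤ.* (b 0 ℤ.* c (suc k) ℤ.+ (drop 1 b ⊛ c) k) ℤ.+ (drop 1 a ⊛ (b ⊛ c)) k
    ≡⟨ cong (λ z → a 0 ℤ.* z ℤ.+ (drop 1 a ⊛ (b ⊛ c)) k) (sym (⊛-suc b c k)) ⟩
  a 0 ℤ.* (b ⊛ c) (suc k) ℤ.+ (drop 1 a ⊛ (b ⊛ c)) k
    ≡⟨ sym (⊛-suc a (b ⊛ c) k) ⟩
  (a ⊛ (b ⊛ c)) (suc k) ∎
  where
  open ≡-Reasoning
  regroup : ∀ x y z w v → x ℤ.* y ℤ.* z ℤ.+ (x ℤ.* w ℤ.+ v) ≡ x ℤ.* (y ℤ.* z ℤ.+ w) ℤ.+ v
  regroup = ℤ-Solver.solve-∀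

^ᴾ-congˡ : ∀ n {a b} → a ≗ b → a ^ᴾ n ≗ b ^ᴾ n
^ᴾ-congˡ zero    _   i = refl
^ᴾ-congˡ (suc n) {a} {b} a≗b i = trans (⊛-congʳ-≗ (a ^ᴾ n) a≗b i) (⊛-congˡ-≗ b (^ᴾ-congˡ n a≗b) i)

zero-^ᴾ : ∀ n .{{_ : NonZero n}} → zeroP ^ᴾ n ≗ zeroP
zero-^ᴾ (suc n) = ⊛-zeroˡ (zeroP ^ᴾ n)

one-^ᴾ : ∀ n → one ^ᴾ n ≗ one
one-^ᴾ zero    i = refl
one-^ᴾ (suc n) i = trans (⊛-identityˡ (one ^ᴾ n) i) (one-^ᴾ n i)

^ᴾ-at-0 : ∀ x j → (x ^ᴾ j) 0 ≡ x 0 ℤ.^ j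
^ᴾ-at-0 x zero    = refl
^ᴾ-at-0 x (suc j) = cong (x 0 ℤ.*_) (^ᴾ-at-0 x j)

-- Monomials, truncations and the Frobenius image

tpow-diag : ∀ K → tpow K K ≡ + 1
tpow-diag K with K ≟ K
... | yes _   = refl
... | no K≢K = contradiction refl K≢K

tpow-off : ∀ {K i} → i ≢ K → tpow K i ≡ + 0
tpow-off {K} {i} i≢K with i ≟ K
... | yes i≡K = contradiction i≡K i≢K
... | no _    = refl

tpow-+ : ∀ a b j → tpow b j ≡ tpow (a + b) (a + j)
tpow-+ a b j = by-cases (j ≟ b)
  where
  by-cases : Dec (j ≡ b) → tpow b j ≡ tpow (a + b) (a + j)
  by-cases (yes refl) = trans (tpow-diag j) (sym (tpow-diag (a + j)))
  by-cases (no j≢b)   = trans (tpow-off j≢b) (sym (tpow-off (j≢b ∘ +-cancelˡ-≡ a j b)))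

tpow-⊛-suc : ∀ K x i → (tpow (suc K) ⊛ x) (suc i) ≡ (tpow K ⊛ x) i
tpow-⊛-suc K x i = begin
  (tpow (suc K) ⊛ x) (suc i)                           ≡⟨ ⊛-suc (tpow (suc K)) x i ⟩
  + 0 ℤ.* x (suc i) ℤ.+ (drop 1 (tpow (suc K)) ⊛ x) i
    ≡⟨ cong₂ ℤ._+_ (ℤ.*-zeroˡ (x (suc i))) (⊛-congʳ-≗ x (sym ∘ tpow-+ 1 K) i) ⟩
  + 0 ℤ.+ (tpow K ⊛ x) i                               ≡⟨ ℤ.+-identityˡ _ ⟩
  (tpow K ⊛ x) i                                       ∎
  where open ≡-Reasoning

tpow-⊛-below : ∀ K x i → i < K → (tpow K ⊛ x) i ≡ + 0
tpow-⊛-below (suc K) x zero    _         = ℤ.*-zeroˡ (x 0)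
tpow-⊛-below (suc K) x (suc i) (s<s i<K) = trans (tpow-⊛-suc K x i) (tpow-⊛-below K x i i<K)

tpow-⊛-+ : ∀ K x j → (tpow K ⊛ x) (K + j) ≡ x j
tpow-⊛-+ zero    x j = ⊛-identityˡ x j
tpow-⊛-+ (suc K) x j = trans (tpow-⊛-suc K x (K + j)) (tpow-⊛-+ K x j)

tpow-⊛-above : ∀ K x i → K ≤ i → (tpow K ⊛ x) i ≡ x (i ∸ K)
tpow-⊛-above K x i K≤i = trans (cong (tpow K ⊛ x) (sym (m+[n∸m]≡n K≤i))) (tpow-⊛-+ K x (i ∸ K))

tpow-⊛-at : ∀ K x → (tpow K ⊛ x) K ≡ x 0
tpow-⊛-at K x = trans (cong (tpow K ⊛ x) (sym (+-identityʳ K))) (tpow-⊛-+ K x 0)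

tpow-⊛-tpow : ∀ a b → tpow a ⊛ tpow b ≗ tpow (a + b)
tpow-⊛-tpow a b i with a ≤? i
... | yes a≤i = begin
  (tpow a ⊛ tpow b) i         ≡⟨ tpow-⊛-above a (tpow b) i a≤i ⟩
  tpow b (i ∸ a)              ≡⟨ tpow-+ a b (i ∸ a) ⟩
  tpow (a + b) (a + (i ∸ a))  ≡⟨ cong (tpow (a + b)) (m+[n∸m]≡n a≤i) ⟩
  tpow (a + b) i              ∎
  where open ≡-Reasoning
... | no a≰i = trans (tpow-⊛-below a (tpow b) i (≰⇒> a≰i))
                     (sym (tpow-off (λ i≡a+b → a≰i (subst (a ≤_) (sym i≡a+b) (m≤m+n a b)))))

tpow1-⊛-drop1 : ∀ v → v 0 ≡ + 0 → tpow 1 ⊛ drop 1 v ≗ v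
tpow1-⊛-drop1 v v₀≡0 zero    = trans (tpow-⊛-below 1 (drop 1 v) 0 z<s) (sym v₀≡0)
tpow1-⊛-drop1 v v₀≡0 (suc i) = tpow-⊛-+ 1 (drop 1 v) i

monomial : ℤ → ℕ → Poly
monomial c K = c • tpow K

monomial-diag : ∀ c K → monomial c K K ≡ c
monomial-diag c K = trans (cong (c ℤ.*_) (tpow-diag K)) (ℤ.*-identityʳ c)

monomial-off : ∀ c {K i} → i ≢ K → monomial c K i ≡ + 0
monomial-off c i≢K = trans (cong (c ℤ.*_) (tpow-off i≢K)) (ℤ.*-zeroʳ c)

monomial-⊛ : ∀ c K d L → monomial c K ⊛ monomial d L ≗ monomial (c ℤ.* d) (K + L)
monomial-⊛ c K d L i = begin
  (monomial c K ⊛ monomial d L) i     ≡⟨ •-⊛ c (tpow K) (monomial d L) i ⟩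
  c ℤ.* (tpow K ⊛ (d • tpow L)) i     ≡⟨ cong (c ℤ.*_) (⊛-• (tpow K) d (tpow L) i) ⟩
  c ℤ.* (d ℤ.* (tpow K ⊛ tpow L) i)   ≡⟨ cong (λ z → c ℤ.* (d ℤ.* z)) (tpow-⊛-tpow K L i) ⟩
  c ℤ.* (d ℤ.* tpow (K + L) i)        ≡⟨ ℤ.*-assoc c d _ ⟨
  monomial (c ℤ.* d) (K + L) i        ∎
  where open ≡-Reasoning

monomial-^ᴾ : ∀ c K n → monomial c K ^ᴾ n ≗ monomial (c ℤ.^ n) (n * K)
monomial-^ᴾ c K zero    i = sym (ℤ.*-identityˡ (one i))
monomial-^ᴾ c K (suc n) i =
  trans (⊛-congˡ-≗ (monomial c K) (monomial-^ᴾ c K n) i) (monomial-⊛ c K (c ℤ.^ n) (n * K) i)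

tpow-^ᴾ : ∀ K n → tpow K ^ᴾ n ≗ tpow (n * K)
tpow-^ᴾ K n i = begin
  (tpow K ^ᴾ n) i                     ≡⟨ ^ᴾ-congˡ n (λ j → sym (ℤ.*-identityˡ (tpow K j))) i ⟩
  (monomial (+ 1) K ^ᴾ n) i           ≡⟨ monomial-^ᴾ (+ 1) K n i ⟩
  (+ 1) ℤ.^ n ℤ.* tpow (n * K) i      ≡⟨ cong (ℤ._* tpow (n * K) i) (ℤ.^-zeroˡ n) ⟩
  + 1 ℤ.* tpow (n * K) i              ≡⟨ ℤ.*-identityˡ _ ⟩
  tpow (n * K) i                      ∎
  where open ≡-Reasoning

truncate : ℕ → Poly → Poly
truncate zero    x = zeroP
truncate (suc K) x = truncate K x ⊕ monomial (x K) K

truncate-above : ∀ K x i → K ≤ i → truncate K x i ≡ + 0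
truncate-above zero    x i _   = refl
truncate-above (suc K) x i K<i =
  cong₂ ℤ._+_ (truncate-above K x i (<⇒≤ K<i)) (monomial-off (x K) (≢-sym (<⇒≢ K<i)))

truncate-below : ∀ K x i → i < K → truncate K x i ≡ x i
truncate-below (suc K) x i i<1+K = by-cases (i ≟ K)
  where
  by-cases : Dec (i ≡ K) → truncate (suc K) x i ≡ x i
  by-cases (yes refl) =
    trans (cong₂ ℤ._+_ (truncate-above i x i ≤-refl) (monomial-diag (x i) i)) (ℤ.+-identityˡ (x i))
  by-cases (no i≢K)   =
    trans (cong₂ ℤ._+_ (truncate-below K x i (≤∧≢⇒< (s≤s⁻¹ i<1+K) i≢K)) (monomial-off (x K) i≢K))
          (ℤ.+-identityʳ (x i))

frobenius : ℕ → ℕ → Poly → Poly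
frobenius p zero    x = zeroP
frobenius p (suc K) x = frobenius p K x ⊕ monomial (x K ℤ.^ p) (p * K)

module _ {p : ℕ} .{{_ : NonZero p}} where

  frobenius-above : ∀ K x i → p * K ≤ i → frobenius p K x i ≡ + 0
  frobenius-above zero    x i _      = refl
  frobenius-above (suc K) x i pK+p≤i =
    cong₂ ℤ._+_ (frobenius-above K x i (<⇒≤ pK<i)) (monomial-off (x K ℤ.^ p) (≢-sym (<⇒≢ pK<i)))
    where
    pK<i : p * K < i
    pK<i = <-≤-trans (*-monoʳ-< p (n<1+n K)) pK+p≤i

  frobenius-off : ∀ K x i → ¬ p ∣ i → frobenius p K x i ≡ + 0
  frobenius-off zero    x i _   = refl
  frobenius-off (suc K) x i p∤i =
    cong₂ ℤ._+_ (frobenius-off K x i p∤i) (monomial-off (x K ℤ.^ p) (λ i≡pK → p∤i (divides K (trans i≡pK (*-comm p K)))))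

  frobenius-at : ∀ K x j → j < K → frobenius p K x (p * j) ≡ x j ℤ.^ p
  frobenius-at (suc K) x j j<1+K with j ≟ K
  ... | yes refl = trans (cong₂ ℤ._+_ (frobenius-above j x (p * j) ≤-refl) (monomial-diag (x j ℤ.^ p) (p * j)))
                         (ℤ.+-identityˡ _)
  ... | no j≢K   = trans (cong₂ ℤ._+_ (frobenius-at K x j (≤∧≢⇒< (s≤s⁻¹ j<1+K) j≢K))
                                      (monomial-off (x K ℤ.^ p) (j≢K ∘ *-cancelˡ-≡ j K p)))
                         (ℤ.+-identityʳ _)

-- Primes and the freshman's dream

prime>1 : ∀ {p} → Prime p → 1 < p
prime>1 {p} pr = nonTrivial⇒n>1 p {{prime⇒nonTrivial pr}}

prime∤1 : ∀ {p} → Prime p → ¬ p ∣ 1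
prime∤1 pr p∣1 = <⇒≢ (prime>1 pr) (sym (∣1⇒≡1 p∣1))

prime∤factorial : ∀ {p} → Prime p → ∀ k → k < p → ¬ p ∣ k !
prime∤factorial pr zero    k<p = prime∤1 pr
prime∤factorial pr (suc k) k<p p∣k! with euclidsLemma (suc k) (k !) pr p∣k!
... | inj₁ p∣1+k = <⇒≱ k<p (∣⇒≤ p∣1+k)
... | inj₂ p∣k!  = prime∤factorial pr k (<-trans (n<1+n k) k<p) p∣k!

prime∣choose : ∀ {p k} → Prime p → 0 < k → k < p → p ∣ p C k
prime∣choose {p@(suc q)} {k} pr 0<k k<p with euclidsLemma (p C k) (k ! * (p ∸ k) !) pr p∣C*k!*[p-k]!
  where
  instance _ = k !* (p ∸ k) !≢0
  p∣C*k!*[p-k]! : p ∣ (p C k) * (k ! * (p ∸ k) !)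
  p∣C*k!*[p-k]! = subst (p ∣_) (sym (begin
    (p C k) * (k ! * (p ∸ k) !)                   ≡⟨ cong (_* (k ! * (p ∸ k) !)) (nCk≡n!/k![n-k]! (<⇒≤ k<p)) ⟩
    (p ! / (k ! * (p ∸ k) !)) * (k ! * (p ∸ k) !) ≡⟨ m/n*n≡m (k![n∸k]!∣n! (<⇒≤ k<p)) ⟩
    p !                                           ∎)) (m∣m*n (q !))
    where open ≡-Reasoning
... | inj₁ p∣C = p∣C
... | inj₂ p∣k!*[p-k]! with euclidsLemma (k !) ((p ∸ k) !) pr p∣k!*[p-k]!
...   | inj₁ p∣k!     = contradiction p∣k! (prime∤factorial pr k k<p)
...   | inj₂ p∣[p-k]! = contradiction p∣[p-k]! (prime∤factorial pr (p ∸ k) (∸-monoʳ-< 0<k (<⇒≤ k<p)))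

module FreshmansDream {c ℓ} (S : CommutativeSemiring c ℓ) where

  private module S = CommutativeSemiring S
  open import Algebra.Properties.Semiring.Exp S.semiring using () renaming (_^_ to _^ˢ_)
  open import Algebra.Properties.CommutativeSemiring.Binomial S using (theorem; binomialTerm)
  open import Algebra.Definitions.RawMonoid S.+-rawMonoid using (sum) renaming (_×_ to _×ₙ_)
  open import Algebra.Properties.Monoid.Mult S.+-monoid using (×-assocˡ; ×-congʳ; ×-homo-1)
  open import Relation.Binary.Reasoning.Setoid S.setoid

  sum-last : ∀ m (g : Fin (suc m) → S.Carrier) → (∀ i → toℕ i < m → g i S.≈ S.0#) → sum g S.≈ g (fromℕ m)
  sum-last zero    g _   = S.+-identityʳ (g Fin.zero)
  sum-last (suc m) g g≈0 = S.trans
    (S.+-cong (g≈0 Fin.zero z<s) (sum-last m (g ∘ Fin.suc) (λ i i<m → g≈0 (Fin.suc i) (s<s i<m))))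
    (S.+-identityˡ _)

  ×-zeroʳ : ∀ n → n ×ₙ S.0# S.≈ S.0#
  ×-zeroʳ zero    = S.refl
  ×-zeroʳ (suc n) = S.trans (S.+-identityˡ (n ×ₙ S.0#)) (×-zeroʳ n)

  ×-vanish : ∀ {p n} → (∀ x → p ×ₙ x S.≈ S.0#) → p ∣ n → ∀ x → n ×ₙ x S.≈ S.0#
  ×-vanish {p} p×≈0 (divides j refl) x =
    S.trans (S.sym (×-assocˡ x j p)) (S.trans (×-congʳ j (p×≈0 x)) (×-zeroʳ j))

  freshman's-dream : ∀ {p} → Prime p → (∀ x → p ×ₙ x S.≈ S.0#) → ∀ x y → (x S.+ y) ^ˢ p S.≈ x ^ˢ p S.+ y ^ˢ p
  freshman's-dream {p@(suc q)} pr p×≈0 x y = begin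
    (x S.+ y) ^ˢ p                                                        ≈⟨ theorem p x y ⟩
    binomialTerm x y p Fin.zero S.+ sum (binomialTerm x y p ∘ Fin.suc)   ≈⟨ S.+-cong first (sum-last q _ middle) ⟩
    y ^ˢ p S.+ binomialTerm x y p (Fin.suc (fromℕ q))                     ≈⟨ S.+-congˡ (last _ (cong suc (toℕ-fromℕ q))) ⟩
    y ^ˢ p S.+ x ^ˢ p                                                      ≈⟨ S.+-comm (y ^ˢ p) (x ^ˢ p) ⟩
    x ^ˢ p S.+ y ^ˢ p                                                      ∎
    where
    first : binomialTerm x y p Fin.zero S.≈ y ^ˢ p
    first = S.trans (×-homo-1 (S.1# S.* y ^ˢ p)) (S.*-identityˡ (y ^ˢ p))
    middle : ∀ i → toℕ i < q → binomialTerm x y p (Fin.suc i) S.≈ S.0#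
    middle i i<q = ×-vanish p×≈0 (prime∣choose pr z<s (s<s i<q)) _
    last : ∀ j → j ≡ p → (p C j) ×ₙ (x ^ˢ j S.* y ^ˢ (p ∸ j)) S.≈ x ^ˢ p
    last .p refl rewrite nCn≡1 p | n∸n≡0 p = S.trans (×-homo-1 _) (S.*-identityʳ (x ^ˢ p))

-- The ring F_p[t]/(t^N)

DivBy : ℕ → ℤ → Set
DivBy p x = + p ℤ∣.∣ x

DivBy-zero : ∀ p → DivBy p (+ 0)
DivBy-zero p = ℤ∣.divides (+ 0) refl

DivBy-sumTo : ∀ p k f → (∀ i → i ≤ k → DivBy p (f i)) → DivBy p (sumTo k f)
DivBy-sumTo p zero    f p∣f = p∣f 0 z≤n
DivBy-sumTo p (suc k) f p∣f =
  ∣m∣n⇒∣m+n (DivBy-sumTo p k f (λ i i≤k → p∣f i (m≤n⇒m≤1+n i≤k))) (p∣f (suc k) ≤-refl)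

DivBy-* : ∀ {p} → Prime p → ∀ a b → DivBy p (a ℤ.* b) → DivBy p a ⊎ DivBy p b
DivBy-* {p} pr a b p∣ab with euclidsLemma ℤ.∣ a ∣ ℤ.∣ b ∣ pr (subst (p ∣_) (ℤ.abs-* a b) (∣⇒∣ᵤ p∣ab))
... | inj₁ p∣a = inj₁ (∣ᵤ⇒∣ p∣a)
... | inj₂ p∣b = inj₂ (∣ᵤ⇒∣ p∣b)

¬DivBy-1 : ∀ {p} → Prime p → ¬ DivBy p (+ 1)
¬DivBy-1 pr p∣1 = prime∤1 pr (∣⇒∣ᵤ p∣1)

DivBy-^ : ∀ {p} → Prime p → ∀ a j → DivBy p (a ℤ.^ j) → DivBy p a
DivBy-^ pr a zero    p∣1 = contradiction p∣1 (¬DivBy-1 pr)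
DivBy-^ pr a (suc j) p∣aʲ⁺¹ with DivBy-* pr a (a ℤ.^ j) p∣aʲ⁺¹
... | inj₁ p∣a  = p∣a
... | inj₂ p∣aʲ = DivBy-^ pr a j p∣aʲ

DivBy-−ˡ : ∀ {p} x y → DivBy p (x ℤ.- y) → DivBy p x → DivBy p y
DivBy-−ˡ {p} x y p∣x-y p∣x = subst (DivBy p) (ℤ.neg-involutive y) (∣m⇒∣-m (ℤ∣.∣m+n∣m⇒∣n p∣x-y p∣x))

module Quotient (p N : ℕ) where

  -- Eq p N as a record, so that both sides can be inferred from a proof.
  infix 4 _≈_
  record _≈_ (a b : Poly) : Set where
    constructor mk≈
    field coeff : ∀ i → i < N → DivBy p (a i ℤ.- b i)
  open _≈_ public

  Eq⇒≈ : ∀ {a b} → Eq p N a b → a ≈ b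
  Eq⇒≈ a≡b = mk≈ (λ i i<N → ∣ᵤ⇒∣ (a≡b i i<N))

  ≈⇒Eq : ∀ {a b} → a ≈ b → Eq p N a b
  ≈⇒Eq a≈b i i<N = ∣⇒∣ᵤ (coeff a≈b i i<N)

  ≈-by-coeff : ∀ {a b} → (∀ i → i < N → a i ℤ.- b i ≡ + 0) → a ≈ b
  ≈-by-coeff a-b≡0 = mk≈ (λ i i<N → subst (DivBy p) (sym (a-b≡0 i i<N)) (DivBy-zero p))

  ≗⇒≈ : ∀ {a b} → a ≗ b → a ≈ b
  ≗⇒≈ {a} a≗b = ≈-by-coeff (λ i _ → trans (cong (λ z → a i ℤ.- z) (sym (a≗b i))) (ℤ.+-inverseʳ (a i)))

  ≈-refl : ∀ {a} → a ≈ a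
  ≈-refl = ≗⇒≈ (λ _ → refl)

  ≈-sym : ∀ {a b} → a ≈ b → b ≈ a
  ≈-sym {a} {b} a≈b = mk≈ λ i i<N → subst (DivBy p) (negate-diff (a i) (b i)) (∣m⇒∣-m (coeff a≈b i i<N))
    where
    negate-diff : ∀ x y → ℤ.- (x ℤ.- y) ≡ y ℤ.- x
    negate-diff = ℤ-Solver.solve-∀

  ≈-trans : ∀ {a b c} → a ≈ b → b ≈ c → a ≈ c
  ≈-trans {a} {b} {c} a≈b b≈c = mk≈ λ i i<N →
    subst (DivBy p) (telescope (a i) (b i) (c i)) (∣m∣n⇒∣m+n (coeff a≈b i i<N) (coeff b≈c i i<N))
    where
    telescope : ∀ x y z → (x ℤ.- y) ℤ.+ (y ℤ.- z) ≡ x ℤ.- z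
    telescope = ℤ-Solver.solve-∀

  ≈-reflexive : ∀ {a b} → a ≡ b → a ≈ b
  ≈-reflexive refl = ≈-refl

  ⊕-cong : ∀ {a a′ b b′} → a ≈ a′ → b ≈ b′ → a ⊕ b ≈ a′ ⊕ b′
  ⊕-cong {a} {a′} {b} {b′} a≈a′ b≈b′ = mk≈ λ i i<N →
    subst (DivBy p) (interchange (a i) (b i) (a′ i) (b′ i)) (∣m∣n⇒∣m+n (coeff a≈a′ i i<N) (coeff b≈b′ i i<N))
    where
    interchange : ∀ x y x′ y′ → (x ℤ.- x′) ℤ.+ (y ℤ.- y′) ≡ (x ℤ.+ y) ℤ.- (x′ ℤ.+ y′)
    interchange = ℤ-Solver.solve-∀

  ⊝-cong : ∀ {a a′} → a ≈ a′ → ⊝ a ≈ ⊝ a′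
  ⊝-cong {a} {a′} a≈a′ = mk≈ λ i i<N → subst (DivBy p) (negate-diff (a i) (a′ i)) (∣m⇒∣-m (coeff a≈a′ i i<N))
    where
    negate-diff : ∀ x y → ℤ.- (x ℤ.- y) ≡ ℤ.- x ℤ.- ℤ.- y
    negate-diff = ℤ-Solver.solve-∀

  ⊛-congʳ : ∀ b {a a′} → a ≈ a′ → a ⊛ b ≈ a′ ⊛ b
  ⊛-congʳ b {a} {a′} a≈a′ = mk≈ λ k k<N →
    subst (DivBy p) (product-diff k)
      (DivBy-sumTo p k _ (λ i i≤k → ∣m⇒∣m*n (b (k ∸ i)) (coeff a≈a′ i (≤-<-trans i≤k k<N))))
    where
    product-diff : ∀ k → ((a ⊕ ⊝ a′) ⊛ b) k ≡ (a ⊛ b) k ℤ.- (a′ ⊛ b) k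
    product-diff k = trans (⊛-distribʳ a (⊝ a′) b k) (cong (λ z → (a ⊛ b) k ℤ.+ z) (⊝-⊛ a′ b k))

  ⊛-cong : ∀ {a a′ b b′} → a ≈ a′ → b ≈ b′ → a ⊛ b ≈ a′ ⊛ b′
  ⊛-cong {a} {a′} {b} {b′} a≈a′ b≈b′ =
    ≈-trans (⊛-congʳ b a≈a′) (≈-trans (≗⇒≈ (⊛-comm a′ b))
      (≈-trans (⊛-congʳ a′ b≈b′) (≗⇒≈ (⊛-comm b′ a′))))

  -- The fixed operand is explicit: _⊕_ and _⊛_ compute, so it cannot be recovered from a goal.
  ⊛-congˡ : ∀ a {b b′} → b ≈ b′ → a ⊛ b ≈ a ⊛ b′
  ⊛-congˡ a b≈b′ = ⊛-cong (≈-refl {a}) b≈b′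

  ⊕-congˡ : ∀ a {b b′} → b ≈ b′ → a ⊕ b ≈ a ⊕ b′
  ⊕-congˡ a b≈b′ = ⊕-cong (≈-refl {a}) b≈b′

  ⊕-congʳ : ∀ b {a a′} → a ≈ a′ → a ⊕ b ≈ a′ ⊕ b
  ⊕-congʳ b a≈a′ = ⊕-cong a≈a′ (≈-refl {b})

  isCommutativeRing : IsCommutativeRing _≈_ _⊕_ _⊛_ ⊝_ zeroP one
  isCommutativeRing = record
    { isRing = record
      { +-isAbelianGroup = record
        { isGroup = record
          { isMonoid = record
            { isSemigroup = record
              { isMagma = record
                { isEquivalence = record { refl = ≈-refl ; sym = ≈-sym ; trans = ≈-trans }
                ; ∙-cong = ⊕-cong
                }
              ; assoc = λ a b c → ≗⇒≈ (λ i → ℤ.+-assoc (a i) (b i) (c i))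
              }
            ; identity = (λ a → ≗⇒≈ (ℤ.+-identityˡ ∘ a)) , (λ a → ≗⇒≈ (ℤ.+-identityʳ ∘ a))
            }
          ; inverse = (λ a → ≗⇒≈ (ℤ.+-inverseˡ ∘ a)) , (λ a → ≗⇒≈ (ℤ.+-inverseʳ ∘ a))
          ; ⁻¹-cong = ⊝-cong
          }
        ; comm = λ a b → ≗⇒≈ (λ i → ℤ.+-comm (a i) (b i))
        }
      ; *-cong = ⊛-cong
      ; *-assoc = λ a b c → ≗⇒≈ (⊛-assoc a b c)
      ; *-identity = (λ a → ≗⇒≈ (⊛-identityˡ a)) , (λ a → ≗⇒≈ (λ k → trans (⊛-comm a one k) (⊛-identityˡ a k)))
      ; distrib = (λ a b c → ≗⇒≈ (⊛-distribˡ a b c)) , (λ a b c → ≗⇒≈ (⊛-distribʳ b c a))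
      }
    ; *-comm = λ a b → ≗⇒≈ (⊛-comm a b)
    }

  ring : CommutativeRing _ _
  ring = record { isCommutativeRing = isCommutativeRing }

  module ≈-Reasoning = Relation.Binary.Reasoning.Setoid (CommutativeRing.setoid ring)

  -- constant (+ 1) is one itself, so that the solver's 1 is definitionally one.
  private
    constant : ℤ → Poly
    constant (+ 1) = one
    constant c     = c • one

    constant-• : ∀ c → constant c ≗ c • one
    constant-• (+ 0)             i = refl
    constant-• (+ 1)             i = sym (ℤ.*-identityˡ (one i))
    constant-• (+ suc (suc n))   i = refl
    constant-• ℤ.-[1+ n ]        i = refl

    constant-* : ∀ c d → constant (c ℤ.* d) ≗ constant c ⊛ constant d
    constant-* c d i = begin
      constant (c ℤ.* d) i                 ≡⟨ constant-• (c ℤ.* d) i ⟩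
      c ℤ.* d ℤ.* one i                    ≡⟨ ℤ.*-assoc c d (one i) ⟩
      c ℤ.* (d ℤ.* one i)                  ≡⟨ cong (λ z → c ℤ.* (d ℤ.* z)) (⊛-identityˡ one i) ⟨
      c ℤ.* (d ℤ.* (one ⊛ one) i)          ≡⟨ cong (c ℤ.*_) (⊛-• one d one i) ⟨
      c ℤ.* (one ⊛ (d • one)) i            ≡⟨ •-⊛ c one (d • one) i ⟨
      ((c • one) ⊛ (d • one)) i            ≡⟨ ⊛-congˡ-≗ (c • one) (constant-• d) i ⟨
      ((c • one) ⊛ constant d) i           ≡⟨ ⊛-congʳ-≗ (constant d) (constant-• c) i ⟨
      (constant c ⊛ constant d) i          ∎
      where open ≡-Reasoning

    constant-homo : ℤ.+-*-rawRing -Raw-AlmostCommutative⟶ fromCommutativeRing ring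
    constant-homo = record
      { ⟦_⟧    = constant
      ; +-homo = λ c d → ≗⇒≈ λ i → trans (constant-• (c ℤ.+ d) i)
                   (trans (ℤ.*-distribʳ-+ (one i) c d) (sym (cong₂ ℤ._+_ (constant-• c i) (constant-• d i))))
      ; *-homo = λ c d → ≗⇒≈ (constant-* c d)
      ; -‿homo = λ c → ≗⇒≈ λ i → trans (constant-• (ℤ.- c) i)
                   (trans (sym (ℤ.neg-distribˡ-* c (one i))) (cong ℤ.-_ (sym (constant-• c i))))
      ; 0-homo = ≗⇒≈ (ℤ.*-zeroˡ ∘ one)
      ; 1-homo = ≈-refl
      }

    constant-≟ : ∀ c d → Maybe (constant c ≈ constant d)
    constant-≟ c d with c ℤ.≟ d
    ... | yes refl = just ≈-refl
    ... | no _     = nothing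

  open import Algebra.Solver.Ring ℤ.+-*-rawRing (fromCommutativeRing ring) constant-homo constant-≟ public
    using (solve; _:=_; _:+_; _:*_; _:-_; Polynomial)
  open import Algebra.Solver.Ring ℤ.+-*-rawRing (fromCommutativeRing ring) constant-homo constant-≟
    using (con)

  :1 : ∀ {k} → Polynomial k
  :1 = con (+ 1)

  one-⊖-⊛ : ∀ a b → (one ⊖ a) ⊕ a ⊛ (one ⊖ b) ≈ one ⊖ a ⊛ b
  one-⊖-⊛ = solve 2 (λ a b → (:1 :- a) :+ a :* (:1 :- b) := :1 :- a :* b) ≈-refl

  ^ᴾ-cong : ∀ {a b} n → a ≈ b → a ^ᴾ n ≈ b ^ᴾ n
  ^ᴾ-cong zero    a≈b = ≈-refl
  ^ᴾ-cong (suc n) a≈b = ⊛-cong a≈b (^ᴾ-cong n a≈b)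

  ^ᴾ-distrib-⊛ : ∀ a b n → (a ⊛ b) ^ᴾ n ≈ a ^ᴾ n ⊛ b ^ᴾ n
  ^ᴾ-distrib-⊛ a b zero    = ≗⇒≈ (λ i → sym (⊛-identityˡ one i))
  ^ᴾ-distrib-⊛ a b (suc n) =
    ≈-trans (⊛-cong (≈-refl {a ⊛ b}) (^ᴾ-distrib-⊛ a b n)) (interchange a b (a ^ᴾ n) (b ^ᴾ n))
    where
    interchange : ∀ a b c d → (a ⊛ b) ⊛ (c ⊛ d) ≈ (a ⊛ c) ⊛ (b ⊛ d)
    interchange = solve 4 (λ a b c d → (a :* b) :* (c :* d) := (a :* c) :* (b :* d)) ≈-refl

  open CommutativeRing ring using (commutativeSemiring)
  open import Algebra.Properties.Semiring.Exp (CommutativeRing.semiring ring) using () renaming (_^_ to _^ʳ_)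
  open import Algebra.Definitions.RawMonoid (CommutativeRing.+-rawMonoid ring) using () renaming (_×_ to _×ₙ_)

  ^ᴾ≗^ʳ : ∀ a n → a ^ᴾ n ≗ a ^ʳ n
  ^ᴾ≗^ʳ a zero    i = refl
  ^ᴾ≗^ʳ a (suc n) = ⊛-congˡ-≗ a (^ᴾ≗^ʳ a n)

  ×-coeff : ∀ n a i → (n ×ₙ a) i ≡ + n ℤ.* a i
  ×-coeff zero    a i = sym (ℤ.*-zeroˡ (a i))
  ×-coeff (suc n) a i = trans (cong (λ z → a i ℤ.+ z) (×-coeff n a i)) (sym (ℤ.suc-* (+ n) (a i)))

  p×≈0 : ∀ a → p ×ₙ a ≈ zeroP
  p×≈0 a = mk≈ λ i _ → subst (DivBy p) (sym (trans (cong (ℤ._- + 0) (×-coeff p a i)) (ℤ.+-identityʳ _)))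
                                        (∣m⇒∣m*n (a i) (ℤ∣.∣-refl))

  ^p-distrib-⊕ : Prime p → ∀ a b → (a ⊕ b) ^ᴾ p ≈ a ^ᴾ p ⊕ b ^ᴾ p
  ^p-distrib-⊕ pr a b = begin
    (a ⊕ b) ^ᴾ p           ≈⟨ ≗⇒≈ (^ᴾ≗^ʳ (a ⊕ b) p) ⟩
    (a ⊕ b) ^ʳ p           ≈⟨ FreshmansDream.freshman's-dream commutativeSemiring pr p×≈0 a b ⟩
    a ^ʳ p ⊕ b ^ʳ p        ≈⟨ ≈-sym (≗⇒≈ (λ i → cong₂ ℤ._+_ (^ᴾ≗^ʳ a p i) (^ᴾ≗^ʳ b p i))) ⟩
    a ^ᴾ p ⊕ b ^ᴾ p        ∎
    where open ≈-Reasoning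

  tpow-⊛-vanish : ∀ K x → N ≤ K → tpow K ⊛ x ≈ zeroP
  tpow-⊛-vanish K x N≤K = ≈-by-coeff λ i i<N →
    trans (cong (ℤ._- + 0) (tpow-⊛-below K x i (<-≤-trans i<N N≤K))) refl

  truncate-≈ : ∀ x → truncate N x ≈ x
  truncate-≈ x = ≈-by-coeff λ i i<N →
    trans (cong (ℤ._- x i) (truncate-below N x i i<N)) (ℤ.+-inverseʳ (x i))

  ^p≈frobenius : Prime p → ∀ x → x ^ᴾ p ≈ frobenius p N x
  ^p≈frobenius pr x = ≈-trans (^ᴾ-cong p (≈-sym (truncate-≈ x))) (truncate-^p N)
    where
    instance _ = prime⇒nonZero pr
    truncate-^p : ∀ K → truncate K x ^ᴾ p ≈ frobenius p K x
    truncate-^p zero    = ≗⇒≈ (zero-^ᴾ p)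
    truncate-^p (suc K) = ≈-trans (^p-distrib-⊕ pr (truncate K x) (monomial (x K) K))
                            (⊕-cong (truncate-^p K) (≗⇒≈ (monomial-^ᴾ (x K) K p)))

  geometric : ℕ → Poly → Poly
  geometric zero    v = zeroP
  geometric (suc K) v = one ⊕ v ⊛ geometric K v

  geometric-sum : ∀ K v → (one ⊖ v) ⊛ geometric K v ≈ one ⊖ v ^ᴾ K
  geometric-sum zero    v = ≗⇒≈ λ i →
    trans (⊛-comm (one ⊖ v) zeroP i) (trans (⊛-zeroˡ (one ⊖ v) i) (sym (ℤ.+-inverseʳ (one i))))
  geometric-sum (suc K) v = begin
    (one ⊖ v) ⊛ (one ⊕ v ⊛ geometric K v)            ≈⟨ expand v (geometric K v) ⟩
    (one ⊖ v) ⊕ v ⊛ ((one ⊖ v) ⊛ geometric K v)      ≈⟨ ⊕-congˡ (one ⊖ v) (⊛-congˡ v (geometric-sum K v)) ⟩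
    (one ⊖ v) ⊕ v ⊛ (one ⊖ v ^ᴾ K)                   ≈⟨ one-⊖-⊛ v (v ^ᴾ K) ⟩
    one ⊖ v ^ᴾ suc K                                 ∎
    where
    open ≈-Reasoning
    expand : ∀ v G → (one ⊖ v) ⊛ (one ⊕ v ⊛ G) ≈ (one ⊖ v) ⊕ v ⊛ ((one ⊖ v) ⊛ G)
    expand = solve 2 (λ v G → (:1 :- v) :* (:1 :+ v :* G) := (:1 :- v) :+ v :* ((:1 :- v) :* G)) ≈-refl

  geometric-at-0 : ∀ K v → v 0 ≡ + 0 → geometric (suc K) v 0 ≡ + 1
  geometric-at-0 K v v₀≡0 rewrite v₀≡0 = cong (λ z → + 1 ℤ.+ z) (ℤ.*-zeroˡ (geometric K v 0))

  ^N-vanish : ∀ v → v 0 ≡ + 0 → v ^ᴾ N ≈ zeroP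
  ^N-vanish v v₀≡0 = begin
    v ^ᴾ N                             ≈⟨ ^ᴾ-cong N (≗⇒≈ (λ i → sym (tpow1-⊛-drop1 v v₀≡0 i))) ⟩
    (tpow 1 ⊛ drop 1 v) ^ᴾ N           ≈⟨ ^ᴾ-distrib-⊛ (tpow 1) (drop 1 v) N ⟩
    tpow 1 ^ᴾ N ⊛ drop 1 v ^ᴾ N        ≈⟨ ⊛-congʳ (drop 1 v ^ᴾ N) (≗⇒≈ (tpow-^ᴾ 1 N)) ⟩
    tpow (N * 1) ⊛ drop 1 v ^ᴾ N       ≈⟨ tpow-⊛-vanish (N * 1) (drop 1 v ^ᴾ N) (≤-reflexive (sym (*-identityʳ N))) ⟩
    zeroP                              ∎
    where open ≈-Reasoning

  inverse : Poly → Poly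
  inverse x = geometric N (one ⊖ x)

  ⊛-inverse : ∀ x → x 0 ≡ + 1 → x ⊛ inverse x ≈ one
  ⊛-inverse x x₀≡1 = begin
    x ⊛ inverse x                       ≈⟨ ⊛-congʳ (inverse x) (double-complement x) ⟩
    (one ⊖ (one ⊖ x)) ⊛ inverse x       ≈⟨ geometric-sum N (one ⊖ x) ⟩
    one ⊖ (one ⊖ x) ^ᴾ N                ≈⟨ ⊕-congˡ one (⊝-cong (^N-vanish (one ⊖ x) 1-x₀≡0)) ⟩
    one ⊖ zeroP                         ≈⟨ ≗⇒≈ (ℤ.+-identityʳ ∘ one) ⟩
    one                                 ∎
    where
    open ≈-Reasoning
    double-complement : ∀ x → x ≈ one ⊖ (one ⊖ x)
    double-complement = solve 1 (λ x → x := :1 :- (:1 :- x)) ≈-refl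
    1-x₀≡0 : (one ⊖ x) 0 ≡ + 0
    1-x₀≡0 rewrite x₀≡1 = refl

  inverse-at-0 : ∀ x → 0 < N → x 0 ≡ + 1 → inverse x 0 ≡ + 1
  inverse-at-0 x (s≤s {n = N-1} _) x₀≡1 = geometric-at-0 N-1 (one ⊖ x) 1-x₀≡0
    where
    1-x₀≡0 : (one ⊖ x) 0 ≡ + 0
    1-x₀≡0 rewrite x₀≡1 = refl

  ≉-zero : Prime p → ∀ {a} i → i < N → a i ≡ + 1 → ¬ a ≈ zeroP
  ≉-zero pr {a} i i<N aᵢ≡1 a≈0 = ¬DivBy-1 pr (subst (DivBy p) (trans (ℤ.+-identityʳ (a i)) aᵢ≡1) (coeff a≈0 i i<N))

  tpow-⊛-^ᴾ : ∀ K u j → (tpow K ⊛ u) ^ᴾ j ≈ tpow (j * K) ⊛ u ^ᴾ j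
  tpow-⊛-^ᴾ K u j = ≈-trans (^ᴾ-distrib-⊛ (tpow K) u j) (⊛-congʳ (u ^ᴾ j) (≗⇒≈ (tpow-^ᴾ K j)))

  tpow-⊛-drop-≈ : ∀ α k → (∀ i → i < k → DivBy p (α i)) → tpow k ⊛ drop k α ≈ α
  tpow-⊛-drop-≈ α k below = mk≈ λ i _ → by-cases i (k ≤? i)
    where
    by-cases : ∀ i → Dec (k ≤ i) → DivBy p ((tpow k ⊛ drop k α) i ℤ.- α i)
    by-cases i (yes k≤i) = subst (DivBy p) (sym (begin
      (tpow k ⊛ drop k α) i ℤ.- α i    ≡⟨ cong (ℤ._- α i) (tpow-⊛-above k (drop k α) i k≤i) ⟩
      α (k + (i ∸ k)) ℤ.- α i          ≡⟨ cong (λ j → α j ℤ.- α i) (m+[n∸m]≡n k≤i) ⟩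
      α i ℤ.- α i                      ≡⟨ ℤ.+-inverseʳ (α i) ⟩
      + 0                              ∎)) (DivBy-zero p)
      where open ≡-Reasoning
    by-cases i (no k≰i) =
      subst (DivBy p) (sym (trans (cong (ℤ._- α i) (tpow-⊛-below k (drop k α) i (≰⇒> k≰i))) (ℤ.+-identityˡ _)))
            (∣m⇒∣-m (below i (≰⇒> k≰i)))

tpow-⊛-cancel : ∀ {p N} K {x y} → Quotient._≈_ p N (tpow K ⊛ x) (tpow K ⊛ y) → Quotient._≈_ p (N ∸ K) x y
tpow-⊛-cancel {p} {N} K {x} {y} tx≈ty = Quotient.mk≈ λ i i<N∸K →
  subst (DivBy p) (cong₂ ℤ._-_ (tpow-⊛-+ K x i) (tpow-⊛-+ K y i)) (Quotient.coeff tx≈ty (K + i) (K+i<N i i<N∸K))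
  where
  K+i<N : ∀ i → i < N ∸ K → K + i < N
  K+i<N i i<N∸K = subst (_≤ N) (trans (+-comm (suc i) K) (+-suc K i)) (m≤o∸n⇒m+n≤o (suc i) K≤N i<N∸K)
    where
    K≤N : K ≤ N
    K≤N = <⇒≤ (m∸n≢0⇒n<m (λ N∸K≡0 → n≮0 (subst (i <_) N∸K≡0 i<N∸K)))

-- The equation and its Artin–Schreier form

module Equations (q N : ℕ) where

  open Quotient (suc q) N

  p : ℕ
  p = suc q

  ArtinSchreier : ℕ → ℕ → Poly → Set
  ArtinSchreier d D x = x ^ᴾ p ⊖ tpow d ⊛ x ≈ one ⊖ tpow D

  artinSchreier-one : ∀ d → ArtinSchreier d (d + 0) one
  artinSchreier-one d = begin
    one ^ᴾ p ⊖ tpow d ⊛ one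
      ≈⟨ ⊕-cong (≗⇒≈ (one-^ᴾ p)) (⊝-cong (≗⇒≈ (λ i → trans (⊛-comm (tpow d) one i) (⊛-identityˡ (tpow d) i)))) ⟩
    one ⊖ tpow d                ≈⟨ ≗⇒≈ (λ i → cong (λ e → one i ℤ.- tpow e i) (sym (+-identityʳ d))) ⟩
    one ⊖ tpow (d + 0)          ∎
    where open ≈-Reasoning

  artinSchreier-step : Prime p → ∀ d D g → ArtinSchreier d D g → ArtinSchreier (p * d) (p * d + D) (one ⊕ tpow d ⊛ g)
  artinSchreier-step pr d D g AS-g = begin
    (one ⊕ tpow d ⊛ g) ^ᴾ p ⊖ T ⊛ (one ⊕ tpow d ⊛ g)    ≈⟨ ⊕-congʳ (⊝ (T ⊛ (one ⊕ tpow d ⊛ g))) frobenius-step ⟩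
    (one ⊕ T ⊛ g ^ᴾ p) ⊖ T ⊛ (one ⊕ tpow d ⊛ g)         ≈⟨ regroup T (g ^ᴾ p) (tpow d) g ⟩
    (one ⊖ T) ⊕ T ⊛ (g ^ᴾ p ⊖ tpow d ⊛ g)                ≈⟨ ⊕-congˡ (one ⊖ T) (⊛-congˡ T AS-g) ⟩
    (one ⊖ T) ⊕ T ⊛ (one ⊖ tpow D)                       ≈⟨ one-⊖-⊛ T (tpow D) ⟩
    one ⊖ T ⊛ tpow D                                     ≈⟨ ⊕-congˡ one (⊝-cong (≗⇒≈ (tpow-⊛-tpow (p * d) D))) ⟩
    one ⊖ tpow (p * d + D)                               ∎
    where
    open ≈-Reasoning
    T = tpow (p * d)
    frobenius-step : (one ⊕ tpow d ⊛ g) ^ᴾ p ≈ one ⊕ T ⊛ g ^ᴾ p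
    frobenius-step = ≈-trans (^p-distrib-⊕ pr one (tpow d ⊛ g))
      (⊕-cong (≗⇒≈ (one-^ᴾ p)) (tpow-⊛-^ᴾ d g p))
    regroup : ∀ A G B g → (one ⊕ A ⊛ G) ⊖ A ⊛ (one ⊕ B ⊛ g) ≈ (one ⊖ A) ⊕ A ⊛ (G ⊖ B ⊛ g)
    regroup = solve 4 (λ A G B g → (:1 :+ A :* G) :- A :* (:1 :+ B :* g) := (:1 :- A) :+ A :* (G :- B :* g)) ≈-refl

  Reciprocal : ℕ → ℕ → Poly → Set
  Reciprocal c δ u = u ^ᴾ p ⊛ (one ⊖ tpow δ) ≈ one ⊖ tpow c ⊛ u ^ᴾ q

  module _ (u w : Poly) (uw≈1 : u ⊛ w ≈ one) where

    private
      U = u ^ᴾ q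
      W = w ^ᴾ q

      UW≈1 : U ⊛ W ≈ one
      UW≈1 = ≈-trans (≈-sym (^ᴾ-distrib-⊛ u w q)) (≈-trans (^ᴾ-cong q uw≈1) (≗⇒≈ (one-^ᴾ q)))

    artinSchreier⇒reciprocal : ∀ c δ → ArtinSchreier c δ w → Reciprocal c δ u
    artinSchreier⇒reciprocal c δ AS-w = begin
      u ^ᴾ p ⊛ (one ⊖ tpow δ)                          ≈⟨ ⊛-congˡ (u ^ᴾ p) (≈-sym AS-w) ⟩
      (u ⊛ U) ⊛ (w ⊛ W ⊖ T ⊛ w)                        ≈⟨ expand u U w W T ⟩
      (u ⊛ w) ⊛ (U ⊛ W) ⊖ T ⊛ (U ⊛ (u ⊛ w))            ≈⟨ ⊕-cong (⊛-cong uw≈1 UW≈1) (⊝-cong (⊛-congˡ T (⊛-congˡ U uw≈1))) ⟩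
      one ⊛ one ⊖ T ⊛ (U ⊛ one)                        ≈⟨ simplify T U ⟩
      one ⊖ T ⊛ U                                      ∎
      where
      open ≈-Reasoning
      T = tpow c
      expand : ∀ u U w W T → (u ⊛ U) ⊛ (w ⊛ W ⊖ T ⊛ w) ≈ (u ⊛ w) ⊛ (U ⊛ W) ⊖ T ⊛ (U ⊛ (u ⊛ w))
      expand = solve 5 (λ u U w W T → (u :* U) :* (w :* W :- T :* w) := (u :* w) :* (U :* W) :- T :* (U :* (u :* w))) ≈-refl
      simplify : ∀ T U → one ⊛ one ⊖ T ⊛ (U ⊛ one) ≈ one ⊖ T ⊛ U
      simplify = solve 2 (λ T U → :1 :* :1 :- T :* (U :* :1) := :1 :- T :* U) ≈-refl

    reciprocal⇒artinSchreier : ∀ c δ → Reciprocal c δ u → ArtinSchreier c δ w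
    reciprocal⇒artinSchreier c δ R-u = begin
      w ⊛ W ⊖ T ⊛ w                                    ≈⟨ ⊕-congˡ (w ⊛ W) (⊝-cong (⊛-congˡ T w≈UWw)) ⟩
      w ⊛ W ⊖ T ⊛ ((U ⊛ W) ⊛ w)                        ≈⟨ factor w W T U ⟩
      (w ⊛ W) ⊛ (one ⊖ T ⊛ U)                          ≈⟨ ⊛-congˡ (w ⊛ W) (≈-sym R-u) ⟩
      (w ⊛ W) ⊛ ((u ⊛ U) ⊛ (one ⊖ tpow δ))             ≈⟨ regroup w W u U (one ⊖ tpow δ) ⟩
      ((u ⊛ w) ⊛ (U ⊛ W)) ⊛ (one ⊖ tpow δ)             ≈⟨ ⊛-congʳ (one ⊖ tpow δ) (⊛-cong uw≈1 UW≈1) ⟩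
      (one ⊛ one) ⊛ (one ⊖ tpow δ)                     ≈⟨ unit (one ⊖ tpow δ) ⟩
      one ⊖ tpow δ                                     ∎
      where
      open ≈-Reasoning
      T = tpow c
      w≈UWw : w ≈ (U ⊛ W) ⊛ w
      w≈UWw = ≈-trans (≈-sym (≗⇒≈ (⊛-identityˡ w))) (⊛-congʳ w (≈-sym UW≈1))
      factor : ∀ w W T U → w ⊛ W ⊖ T ⊛ ((U ⊛ W) ⊛ w) ≈ (w ⊛ W) ⊛ (one ⊖ T ⊛ U)
      factor = solve 4 (λ w W T U → w :* W :- T :* ((U :* W) :* w) := (w :* W) :* (:1 :- T :* U)) ≈-refl
      regroup : ∀ w W u U X → (w ⊛ W) ⊛ ((u ⊛ U) ⊛ X) ≈ ((u ⊛ w) ⊛ (U ⊛ W)) ⊛ X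
      regroup = solve 5 (λ w W u U X → (w :* W) :* ((u :* U) :* X) := ((u :* w) :* (U :* W)) :* X) ≈-refl
      unit : ∀ X → (one ⊛ one) ⊛ X ≈ X
      unit = solve 1 (λ X → (:1 :* :1) :* X := X) ≈-refl

  reciprocal⇒invertible : 0 < q → ∀ u c δ → Reciprocal c δ u → ∃ λ w → u ⊛ w ≈ one
  reciprocal⇒invertible (s≤s z≤n) u c δ R-u = u ^ᴾ (q ∸ 1) ⊛ (u ⊛ (one ⊖ tpow δ) ⊕ tpow c) , (begin
    u ⊛ (V ⊛ (u ⊛ (one ⊖ tpow δ) ⊕ tpow c))              ≈⟨ expand u V (tpow δ) (tpow c) ⟩
    u ^ᴾ p ⊛ (one ⊖ tpow δ) ⊕ tpow c ⊛ u ^ᴾ q             ≈⟨ ⊕-congʳ (tpow c ⊛ u ^ᴾ q) R-u ⟩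
    (one ⊖ tpow c ⊛ u ^ᴾ q) ⊕ tpow c ⊛ u ^ᴾ q             ≈⟨ cancel (tpow c ⊛ u ^ᴾ q) ⟩
    one                                                  ∎)
    where
    open ≈-Reasoning
    V = u ^ᴾ (q ∸ 1)
    expand : ∀ u V D C → u ⊛ (V ⊛ (u ⊛ (one ⊖ D) ⊕ C)) ≈ (u ⊛ (u ⊛ V)) ⊛ (one ⊖ D) ⊕ C ⊛ (u ⊛ V)
    expand = solve 4 (λ u V D C → u :* (V :* (u :* (:1 :- D) :+ C)) := (u :* (u :* V)) :* (:1 :- D) :+ C :* (u :* V)) ≈-refl
    cancel : ∀ X → (one ⊖ X) ⊕ X ≈ one
    cancel = solve 1 (λ X → (:1 :- X) :+ X := :1) ≈-refl

  Equation : ℕ → ℕ → Poly → Set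
  Equation n m α = α ^ᴾ p ⊛ (tpow n ⊖ tpow m) ≈ tpow n ⊛ tpow m ⊛ (one ⊖ α ^ᴾ q)

  Witness : ℕ → ℕ → Poly → Set
  Witness n m α = Equation n m α × ¬ (α ^ᴾ (3 * p) ≈ zeroP)

  equation-one : ∀ n → Equation n n one
  equation-one n = begin
    one ^ᴾ p ⊛ (tpow n ⊖ tpow n)            ≈⟨ ⊛-congʳ (tpow n ⊖ tpow n) (≗⇒≈ (one-^ᴾ p)) ⟩
    one ⊛ (tpow n ⊖ tpow n)                 ≈⟨ cancel (tpow n) ⟩
    tpow n ⊛ tpow n ⊛ (one ⊖ one)           ≈⟨ ⊛-congˡ (tpow n ⊛ tpow n) (⊕-congˡ one (⊝-cong (≗⇒≈ (λ i → sym (one-^ᴾ q i))))) ⟩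
    tpow n ⊛ tpow n ⊛ (one ⊖ one ^ᴾ q)      ∎
    where
    open ≈-Reasoning
    cancel : ∀ T → one ⊛ (T ⊖ T) ≈ T ⊛ T ⊛ (one ⊖ one)
    cancel = solve 1 (λ T → :1 :* (T :- T) := T :* T :* (:1 :- :1)) ≈-refl

  equation⇔ : ∀ {n m δ K α u} → m ≡ n + δ → α ≈ tpow K ⊛ u → Equation n m α ⇔
    (tpow (p * K + n) ⊛ (u ^ᴾ p ⊛ (one ⊖ tpow δ)) ≈ tpow (n + m) ⊛ (one ⊖ tpow (q * K) ⊛ u ^ᴾ q))
  equation⇔ {n} {m} {δ} {K} {α} {u} refl α≈tᴷu =
    mk⇔ (λ e → ≈-trans (≈-sym lhs) (≈-trans e rhs)) (λ e → ≈-trans lhs (≈-trans e (≈-sym rhs)))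
    where
    open ≈-Reasoning
    lhs : α ^ᴾ p ⊛ (tpow n ⊖ tpow m) ≈ tpow (p * K + n) ⊛ (u ^ᴾ p ⊛ (one ⊖ tpow δ))
    lhs = begin
      α ^ᴾ p ⊛ (tpow n ⊖ tpow (n + δ))
        ≈⟨ ⊛-cong (≈-trans (^ᴾ-cong p α≈tᴷu) (tpow-⊛-^ᴾ K u p))
                  (⊕-congˡ (tpow n) (⊝-cong (≗⇒≈ (λ i → sym (tpow-⊛-tpow n δ i))))) ⟩
      (tpow (p * K) ⊛ u ^ᴾ p) ⊛ (tpow n ⊖ tpow n ⊛ tpow δ)
        ≈⟨ regroup (tpow (p * K)) (u ^ᴾ p) (tpow n) (tpow δ) ⟩
      (tpow (p * K) ⊛ tpow n) ⊛ (u ^ᴾ p ⊛ (one ⊖ tpow δ))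
        ≈⟨ ⊛-congʳ (u ^ᴾ p ⊛ (one ⊖ tpow δ)) (≗⇒≈ (tpow-⊛-tpow (p * K) n)) ⟩
      tpow (p * K + n) ⊛ (u ^ᴾ p ⊛ (one ⊖ tpow δ))
        ∎
      where
      regroup : ∀ A X B C → (A ⊛ X) ⊛ (B ⊖ B ⊛ C) ≈ (A ⊛ B) ⊛ (X ⊛ (one ⊖ C))
      regroup = solve 4 (λ A X B C → (A :* X) :* (B :- B :* C) := (A :* B) :* (X :* (:1 :- C))) ≈-refl
    rhs : tpow n ⊛ tpow m ⊛ (one ⊖ α ^ᴾ q) ≈ tpow (n + m) ⊛ (one ⊖ tpow (q * K) ⊛ u ^ᴾ q)
    rhs = ⊛-cong (≗⇒≈ (tpow-⊛-tpow n m)) (⊕-congˡ one (⊝-cong (≈-trans (^ᴾ-cong q α≈tᴷu) (tpow-⊛-^ᴾ K u q))))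

∣ₚ-step : ∀ {p n ρ} → n ∣[ p ] ρ → n ∣[ p ] (p * ρ)
∣ₚ-step {p} {n} (s , ρ≡pˢn) = suc s , trans (cong (p *_) ρ≡pˢn) (sym (*-assoc p (p ^ s) n))

least-counterexample : ∀ {P : ℕ → Set} → (∀ i → Dec (P i)) → ∀ K →
  (∀ i → i < K → P i) ⊎ ∃ λ k → k < K × ¬ P k × (∀ i → i < k → P i)
least-counterexample P? zero    = inj₁ (λ _ ())
least-counterexample P? (suc K) with least-counterexample P? K
... | inj₂ (k , k<K , ¬Pk , below) = inj₂ (k , m≤n⇒m≤1+n k<K , ¬Pk , below)
... | inj₁ below with P? K
...   | no ¬PK = inj₂ (K , ≤-refl , ¬PK , below)
...   | yes PK = inj₁ λ i i<1+K → [ below i , (λ { refl → PK }) ]′ (m≤n⇒m<n∨m≡n (s≤s⁻¹ i<1+K))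

module Forward (q N : ℕ) (p-prime : Prime (suc q)) {n : ℕ} (0<n : 0 < n) where

  open Quotient (suc q) N
  open Equations q N

  e : ℕ → ℕ
  e s = p ^ s * n

  D : ℕ → ℕ
  D zero    = 0
  D (suc s) = q * e s + D s

  g : ℕ → Poly
  g zero    = one
  g (suc s) = one ⊕ tpow (q * e s) ⊛ g s

  n+D≡e : ∀ s → n + D s ≡ e s
  n+D≡e zero    = trans (+-identityʳ n) (sym (*-identityˡ n))
  n+D≡e (suc s) = begin
    n + (q * e s + D s)     ≡⟨ x+[y+z]≡y+[x+z] n (q * e s) (D s) ⟩
    q * e s + (n + D s)     ≡⟨ cong (_+_ (q * e s)) (n+D≡e s) ⟩
    q * e s + e s           ≡⟨ +-comm (q * e s) (e s) ⟩
    p * (p ^ s * n)         ≡⟨ sym (*-assoc p (p ^ s) n) ⟩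
    e (suc s)               ∎
    where
    open ≡-Reasoning
    x+[y+z]≡y+[x+z] : ∀ x y z → x + (y + z) ≡ y + (x + z)
    x+[y+z]≡y+[x+z] = ℕ-Solver.solve-∀

  g-artinSchreier : ∀ s → ArtinSchreier (q * e s) (D (suc s)) (g s)
  g-artinSchreier zero    = artinSchreier-one (q * e 0)
  g-artinSchreier (suc s) =
    subst (λ d → ArtinSchreier d (d + D (suc s)) (g (suc s))) p*q*e≡q*e′
          (artinSchreier-step p-prime (q * e s) (D (suc s)) (g s) (g-artinSchreier s))
    where
    p*q*e≡q*e′ : p * (q * e s) ≡ q * e (suc s)
    p*q*e≡q*e′ = trans (x*[y*z]≡y*[x*z] p q (e s)) (cong (q *_) (sym (*-assoc p (p ^ s) n)))
      where
      x*[y*z]≡y*[x*z] : ∀ x y z → x * (y * z) ≡ y * (x * z)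
      x*[y*z]≡y*[x*z] = ℕ-Solver.solve-∀

  g-at-0 : ∀ s → g s 0 ≡ + 1
  g-at-0 zero    = refl
  g-at-0 (suc s) = cong (λ z → + 1 ℤ.+ z) (tpow-⊛-below (q * e s) (g s) 0 0<q*e)
    where
    0<q*e : 0 < q * e s
    0<q*e = *-mono-≤ (s<s⁻¹ (prime>1 p-prime)) (*-mono-≤ (m^n>0 p s) 0<n)

  witness : ∀ s {m} → m ≡ p ^ suc s * n → 3 * m < N → ∃ (Witness n m)
  witness s {m} m≡pˢ⁺¹n 3m<N = tpow K ⊛ h , equation , nonvanishing
    where
    K = e s
    h = inverse (g s)
    δ = D (suc s)
    m≡pK : m ≡ p * K
    m≡pK = trans m≡pˢ⁺¹n (*-assoc p (p ^ s) n)
    h⊛g≈1 : h ⊛ g s ≈ one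
    h⊛g≈1 = ≈-trans (≗⇒≈ (⊛-comm h (g s))) (⊛-inverse (g s) (g-at-0 s))
    equation : Equation n m (tpow K ⊛ h)
    equation = Equivalence.from (equation⇔ (trans m≡pˢ⁺¹n (sym (n+D≡e (suc s)))) ≈-refl) (begin
      tpow (p * K + n) ⊛ (h ^ᴾ p ⊛ (one ⊖ tpow δ))
        ≈⟨ ≈-reflexive (cong (λ k → tpow k ⊛ (h ^ᴾ p ⊛ (one ⊖ tpow δ))) pK+n≡n+m) ⟩
      tpow (n + m) ⊛ (h ^ᴾ p ⊛ (one ⊖ tpow δ))
        ≈⟨ ⊛-congˡ (tpow (n + m)) (artinSchreier⇒reciprocal h (g s) h⊛g≈1 (q * K) δ (g-artinSchreier s)) ⟩
      tpow (n + m) ⊛ (one ⊖ tpow (q * K) ⊛ h ^ᴾ q)   ∎)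
      where
      open ≈-Reasoning
      pK+n≡n+m : p * K + n ≡ n + m
      pK+n≡n+m = trans (+-comm (p * K) n) (cong (_+_ n) (sym m≡pK))
    nonvanishing : ¬ (tpow K ⊛ h) ^ᴾ (3 * p) ≈ zeroP
    nonvanishing α³ᵖ≈0 = ≉-zero p-prime (3 * p * K) 3pK<N coefficient (≈-trans (≈-sym (tpow-⊛-^ᴾ K h (3 * p))) α³ᵖ≈0)
      where
      3pK<N : 3 * p * K < N
      3pK<N = subst (_< N) (trans (cong (3 *_) m≡pK) (sym (*-assoc 3 p K))) 3m<N
      coefficient : (tpow (3 * p * K) ⊛ h ^ᴾ (3 * p)) (3 * p * K) ≡ + 1
      coefficient = begin
        (tpow (3 * p * K) ⊛ h ^ᴾ (3 * p)) (3 * p * K)  ≡⟨ tpow-⊛-at (3 * p * K) (h ^ᴾ (3 * p)) ⟩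
        (h ^ᴾ (3 * p)) 0                              ≡⟨ ^ᴾ-at-0 h (3 * p) ⟩
        h 0 ℤ.^ (3 * p)                               ≡⟨ cong (ℤ._^ (3 * p)) (inverse-at-0 (g s) (≤-<-trans z≤n 3m<N) (g-at-0 s)) ⟩
        (+ 1) ℤ.^ (3 * p)                             ≡⟨ ℤ.^-zeroˡ (3 * p) ⟩
        + 1                                           ∎
        where open ≡-Reasoning

  forward : ∀ {m} → n ∣[ p ] m → 3 * m < N → ∃ (Witness n m)
  forward (zero , m≡1*n) 3m<N =
    one , subst (λ m → Equation n m one) (sym (trans m≡1*n (*-identityˡ n))) (equation-one n) ,
    ≉-zero p-prime 0 (≤-<-trans z≤n 3m<N) (one-^ᴾ (3 * p) 0)
  forward (suc s , m≡pˢ⁺¹n) 3m<N = witness s m≡pˢ⁺¹n 3m<N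

module Descent (q M : ℕ) (p-prime : Prime (suc q)) {n k δ : ℕ} (w : Poly)
  (0<n : 0 < n) (0<δ : 0 < δ) (pk≡n+δ : suc q * k ≡ n + δ) (pk<M : suc q * k < M)
  (artinSchreier : Quotient._≈_ (suc q) M (frobenius (suc q) M w ⊖ tpow (q * k) ⊛ w) (one ⊖ tpow δ)) where

  open Quotient (suc q) M using (coeff)

  private
    p m c : ℕ
    p = suc q
    m = p * k  -- computes to k + c
    c = q * k

    F : ℕ → ℤ
    F = frobenius p M w

    n≤m : n ≤ m
    n≤m = subst (n ≤_) (sym pk≡n+δ) (m≤m+n n δ)

    0<k : 0 < k
    0<k = n≢0⇒n>0 λ k≡0 → <⇒≱ 0<n (subst (n ≤_) (trans (cong (p *_) k≡0) (*-zeroʳ p)) n≤m)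

    0<c : 0 < c
    0<c = *-mono-≤ (s<s⁻¹ (prime>1 p-prime)) 0<k

    k≤m : k ≤ m
    k≤m = m≤m+n k c

  w₀-unit : ¬ DivBy p (w 0)
  w₀-unit p∣w₀ = ¬DivBy-1 p-prime (DivBy-−ˡ (w 0 ℤ.^ p) (+ 1) p∣w₀ᵖ-1 (∣m⇒∣m*n (w 0 ℤ.^ q) p∣w₀))
    where
    coefficient₀ : (F 0 ℤ.- (tpow c ⊛ w) 0) ℤ.- (+ 1 ℤ.- tpow δ 0) ≡ w 0 ℤ.^ p ℤ.- + 1
    coefficient₀ = begin
      (F 0 ℤ.- (tpow c ⊛ w) 0) ℤ.- (+ 1 ℤ.- tpow δ 0)
        ≡⟨ cong₂ (λ x y → (x ℤ.- y) ℤ.- (+ 1 ℤ.- tpow δ 0))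
                 (trans (cong F (sym (*-zeroʳ p))) (frobenius-at M w 0 (≤-<-trans z≤n pk<M)))
                 (tpow-⊛-below c w 0 0<c) ⟩
      (w 0 ℤ.^ p ℤ.- + 0) ℤ.- (+ 1 ℤ.- tpow δ 0)
        ≡⟨ cong (λ y → (w 0 ℤ.^ p ℤ.- + 0) ℤ.- (+ 1 ℤ.- y)) (tpow-off (<⇒≢ 0<δ)) ⟩
      (w 0 ℤ.^ p ℤ.- + 0) ℤ.- (+ 1 ℤ.- + 0)
        ≡⟨ drop-zeros (w 0 ℤ.^ p) ⟩
      w 0 ℤ.^ p ℤ.- + 1 ∎
      where
      open ≡-Reasoning
      drop-zeros : ∀ a → (a ℤ.- + 0) ℤ.- (+ 1 ℤ.- + 0) ≡ a ℤ.- + 1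
      drop-zeros = ℤ-Solver.solve-∀
    p∣w₀ᵖ-1 : DivBy p (w 0 ℤ.^ p ℤ.- + 1)
    p∣w₀ᵖ-1 = subst (DivBy p) coefficient₀ (coeff artinSchreier 0 (≤-<-trans z≤n pk<M))

  relation-at : ∀ ρ → 0 < ρ → ρ ≤ k → ρ ≢ n → DivBy p (F (m ∸ ρ) ℤ.- w (k ∸ ρ))
  relation-at ρ 0<ρ ρ≤k ρ≢n = subst (DivBy p) coefficient (coeff artinSchreier (m ∸ ρ) (≤-<-trans (m∸n≤m m ρ) pk<M))
    where
    i = m ∸ ρ
    i≡k-ρ+c : i ≡ (k ∸ ρ) + c
    i≡k-ρ+c = +-∸-comm c ρ≤k
    c≤i : c ≤ i
    c≤i = subst (c ≤_) (sym i≡k-ρ+c) (m≤n+m c (k ∸ ρ))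
    i≢0 : i ≢ 0
    i≢0 = <⇒≢ (<-≤-trans 0<c c≤i) ∘ sym
    i≢δ : i ≢ δ
    i≢δ i≡δ = ρ≢n (∸-cancelˡ-≡ (≤-trans ρ≤k k≤m) n≤m (trans i≡δ (sym (trans (cong (_∸ n) pk≡n+δ) (m+n∸m≡n n δ)))))
    coefficient : (F i ℤ.- (tpow c ⊛ w) i) ℤ.- (one i ℤ.- tpow δ i) ≡ F i ℤ.- w (k ∸ ρ)
    coefficient = begin
      (F i ℤ.- (tpow c ⊛ w) i) ℤ.- (one i ℤ.- tpow δ i)
        ≡⟨ cong₂ (λ x y → (F i ℤ.- x) ℤ.- y) (tpow-⊛-above c w i c≤i) (cong₂ ℤ._-_ (tpow-off i≢0) (tpow-off i≢δ)) ⟩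
      (F i ℤ.- w (i ∸ c)) ℤ.- (+ 0 ℤ.- + 0)
        ≡⟨ cong (λ j → (F i ℤ.- w j) ℤ.- (+ 0 ℤ.- + 0)) (trans (cong (_∸ c) i≡k-ρ+c) (m+n∸n≡m (k ∸ ρ) c)) ⟩
      (F i ℤ.- w (k ∸ ρ)) ℤ.- (+ 0 ℤ.- + 0)
        ≡⟨ ℤ.+-identityʳ _ ⟩
      F i ℤ.- w (k ∸ ρ) ∎
      where open ≡-Reasoning

  -- For ρ ≢ n, relation-at makes w (k ∸ ρ) congruent to w (k ∸ ρ / p) ^ p if p ∣ ρ, and to 0 otherwise.
  descent : ∀ ρ → 0 < ρ → ρ ≤ k → ¬ DivBy p (w (k ∸ ρ)) → n ∣[ p ] ρ
  descent = <-rec _ step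
    where
    step : ∀ ρ → (∀ {ρ′} → ρ′ < ρ → 0 < ρ′ → ρ′ ≤ k → ¬ DivBy p (w (k ∸ ρ′)) → n ∣[ p ] ρ′) →
           0 < ρ → ρ ≤ k → ¬ DivBy p (w (k ∸ ρ)) → n ∣[ p ] ρ
    step ρ descent′ 0<ρ ρ≤k p∤w[k-ρ] with ρ ≟ n
    ... | yes refl = 0 , sym (+-identityʳ ρ)
    ... | no ρ≢n with p ∣? ρ
    ...   | no p∤ρ = contradiction (DivBy-−ˡ (F (m ∸ ρ)) (w (k ∸ ρ)) (relation-at ρ 0<ρ ρ≤k ρ≢n) p∣F[m-ρ]) p∤w[k-ρ]
      where
      p∤m-ρ : ¬ p ∣ m ∸ ρ
      p∤m-ρ p∣m-ρ = p∤ρ (∣m+n∣m⇒∣n (subst (p ∣_) (sym (m∸n+n≡m (≤-trans ρ≤k k≤m))) (m∣m*n k)) p∣m-ρ)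
      p∣F[m-ρ] : DivBy p (F (m ∸ ρ))
      p∣F[m-ρ] = subst (DivBy p) (sym (frobenius-off M w (m ∸ ρ) p∤m-ρ)) (DivBy-zero p)
    ...   | yes (divides ρ′ ρ≡ρ′p) = subst (n ∣[ p ]_) (sym ρ≡pρ′) (∣ₚ-step (descent′ ρ′<ρ 0<ρ′ ρ′≤k p∤w[k-ρ′]))
      where
      ρ≡pρ′ : ρ ≡ p * ρ′
      ρ≡pρ′ = trans ρ≡ρ′p (*-comm ρ′ p)
      0<ρ′ : 0 < ρ′
      0<ρ′ = n≢0⇒n>0 λ ρ′≡0 → <⇒≢ 0<ρ (sym (trans ρ≡ρ′p (cong (_* p) ρ′≡0)))
      ρ′<ρ : ρ′ < ρ
      ρ′<ρ = subst (ρ′ <_) (sym ρ≡ρ′p) (m<m*n ρ′ p {{>-nonZero 0<ρ′}} (prime>1 p-prime))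
      ρ′≤k : ρ′ ≤ k
      ρ′≤k = <⇒≤ (<-≤-trans ρ′<ρ ρ≤k)
      F[m-ρ]≡w[k-ρ′]ᵖ : F (m ∸ ρ) ≡ w (k ∸ ρ′) ℤ.^ p
      F[m-ρ]≡w[k-ρ′]ᵖ = trans (cong (λ j → F (m ∸ j)) ρ≡pρ′)
          (trans (cong F (sym (*-distribˡ-∸ p k ρ′)))
               (frobenius-at M w (k ∸ ρ′) (≤-<-trans (m∸n≤m k ρ′) (≤-<-trans k≤m pk<M))))
      p∤w[k-ρ′] : ¬ DivBy p (w (k ∸ ρ′))
      p∤w[k-ρ′] p∣w[k-ρ′] = p∤w[k-ρ] (DivBy-−ˡ (F (m ∸ ρ)) (w (k ∸ ρ)) (relation-at ρ 0<ρ ρ≤k ρ≢n)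
        (subst (DivBy p) (sym F[m-ρ]≡w[k-ρ′]ᵖ) (∣m⇒∣m*n (w (k ∸ ρ′) ℤ.^ q) p∣w[k-ρ′])))

  n∣ₚk : n ∣[ p ] k
  n∣ₚk = descent k 0<k ≤-refl (subst (λ j → ¬ DivBy p (w j)) (sym (n∸n≡0 k)) w₀-unit)

module Reverse (q N : ℕ) (p-prime : Prime (suc q)) {n m : ℕ} (0<n : 0 < n) (n≤m : n ≤ m) (3m<N : 3 * m < N) where

  open Quotient (suc q) N
  open Equations q N

  private
    0<q : 0 < q
    0<q = s<s⁻¹ (prime>1 p-prime)

    n+m<N : n + m < N
    n+m<N = ≤-<-trans (≤-trans (+-monoˡ-≤ m n≤m) (+-monoʳ-≤ m (m≤m+n m (m + 0)))) 3m<N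

  module _ {k δ : ℕ} (u : Poly) (p∤u₀ : ¬ DivBy p (u 0)) (0<δ : 0 < δ) (m≡n+δ : m ≡ n + δ)
    (shifted : tpow (p * k + n) ⊛ (u ^ᴾ p ⊛ (one ⊖ tpow δ)) ≈ tpow (n + m) ⊛ (one ⊖ tpow (q * k) ⊛ u ^ᴾ q)) where

    ¬pk<m : ¬ p * k < m
    ¬pk<m pk<m = p∤u₀ (DivBy-^ p-prime (u 0) p (subst (DivBy p) coefficient (coeff shifted i i<N)))
      where
      i = p * k + n
      i<n+m : i < n + m
      i<n+m = subst (i <_) (+-comm m n) (+-monoˡ-< n pk<m)
      i<N : i < N
      i<N = <-trans i<n+m n+m<N
      coefficient : (tpow i ⊛ (u ^ᴾ p ⊛ (one ⊖ tpow δ))) i ℤ.- (tpow (n + m) ⊛ (one ⊖ tpow (q * k) ⊛ u ^ᴾ q)) i ≡ u 0 ℤ.^ p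
      coefficient = begin
        (tpow i ⊛ (u ^ᴾ p ⊛ (one ⊖ tpow δ))) i ℤ.- (tpow (n + m) ⊛ (one ⊖ tpow (q * k) ⊛ u ^ᴾ q)) i
          ≡⟨ cong₂ ℤ._-_ (tpow-⊛-at i (u ^ᴾ p ⊛ (one ⊖ tpow δ)))
                         (tpow-⊛-below (n + m) (one ⊖ tpow (q * k) ⊛ u ^ᴾ q) i i<n+m) ⟩
        (u ^ᴾ p) 0 ℤ.* (+ 1 ℤ.- tpow δ 0) ℤ.- + 0
          ≡⟨ cong (λ z → (u ^ᴾ p) 0 ℤ.* (+ 1 ℤ.- z) ℤ.- + 0) (tpow-off (<⇒≢ 0<δ)) ⟩
        (u ^ᴾ p) 0 ℤ.* (+ 1 ℤ.- + 0) ℤ.- + 0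
          ≡⟨ trans (ℤ.+-identityʳ _) (ℤ.*-identityʳ _) ⟩
        (u ^ᴾ p) 0
          ≡⟨ ^ᴾ-at-0 u p ⟩
        u 0 ℤ.^ p ∎
        where open ≡-Reasoning

    ¬m<pk : ¬ m < p * k
    ¬m<pk m<pk = ¬DivBy-1 p-prime (DivBy-−ˡ (+ 0) (+ 1) (subst (DivBy p) coefficient (coeff shifted i n+m<N)) (DivBy-zero p))
      where
      i = n + m
      0<k : 0 < k
      0<k = n≢0⇒n>0 λ k≡0 → n≮0 (subst (m <_) (trans (cong (p *_) k≡0) (*-zeroʳ p)) m<pk)
      coefficient : (tpow (p * k + n) ⊛ (u ^ᴾ p ⊛ (one ⊖ tpow δ))) i ℤ.- (tpow i ⊛ (one ⊖ tpow (q * k) ⊛ u ^ᴾ q)) i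
                  ≡ + 0 ℤ.- + 1
      coefficient = begin
        (tpow (p * k + n) ⊛ (u ^ᴾ p ⊛ (one ⊖ tpow δ))) i ℤ.- (tpow i ⊛ (one ⊖ tpow (q * k) ⊛ u ^ᴾ q)) i
          ≡⟨ cong₂ ℤ._-_ (tpow-⊛-below (p * k + n) (u ^ᴾ p ⊛ (one ⊖ tpow δ)) i
                                       (subst (_< p * k + n) (+-comm m n) (+-monoˡ-< n m<pk)))
                         (tpow-⊛-at i (one ⊖ tpow (q * k) ⊛ u ^ᴾ q)) ⟩
        + 0 ℤ.- (+ 1 ℤ.- (tpow (q * k) ⊛ u ^ᴾ q) 0)
          ≡⟨ cong (λ z → + 0 ℤ.- (+ 1 ℤ.- z)) (tpow-⊛-below (q * k) (u ^ᴾ q) 0 (*-mono-≤ 0<q 0<k)) ⟩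
        + 0 ℤ.- (+ 1 ℤ.- + 0)
          ≡⟨⟩
        + 0 ℤ.- + 1 ∎
        where open ≡-Reasoning

    pk≡m⇒n∣ₚm : p * k ≡ m → n ∣[ p ] m
    pk≡m⇒n∣ₚm pk≡m =
      subst (n ∣[ p ]_) pk≡m (∣ₚ-step (Descent.n∣ₚk q M p-prime w 0<n 0<δ (trans pk≡m m≡n+δ) pk<M artinSchreier))
      where
      M = N ∸ (n + m)
      module M = Quotient p M
      reciprocal : Equations.Reciprocal q M (q * k) δ u
      reciprocal = tpow-⊛-cancel (n + m)
        (≈-trans (≈-reflexive (cong (λ j → tpow j ⊛ (u ^ᴾ p ⊛ (one ⊖ tpow δ))) (sym pk+n≡n+m))) shifted)
        where
        pk+n≡n+m : p * k + n ≡ n + m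
        pk+n≡n+m = trans (+-comm (p * k) n) (cong (_+_ n) pk≡m)
      invertible = Equations.reciprocal⇒invertible q M 0<q u (q * k) δ reciprocal
      w = proj₁ invertible
      artinSchreier : M._≈_ (frobenius p M w ⊖ tpow (q * k) ⊛ w) (one ⊖ tpow δ)
      artinSchreier = M.≈-trans (M.⊕-congʳ (⊝ (tpow (q * k) ⊛ w)) (M.≈-sym (M.^p≈frobenius p-prime w)))
        (Equations.reciprocal⇒artinSchreier q M u w (proj₂ invertible) (q * k) δ reciprocal)
      pk<M : p * k < M
      pk<M = m+n≤o⇒m≤o∸n (suc (p * k)) (subst (λ j → suc j + (n + m) ≤ N) (sym pk≡m) m+[n+m]<N)
        where
        m+[n+m]<N : m + (n + m) < N
        m+[n+m]<N = ≤-<-trans (+-monoʳ-≤ m (+-mono-≤ n≤m (m≤m+n m 0))) 3m<N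

  ∣ₚ-from-valuation : ∀ {α} k → Equation n m α → ¬ DivBy p (α k) → (∀ i → i < k → DivBy p (α i)) →
                      n ≢ m → n ∣[ p ] m
  ∣ₚ-from-valuation {α} k equation p∤αₖ below n≢m = by-comparison (<-cmp (p * k) m)
    where
    u = drop k α
    δ = m ∸ n
    p∤u₀ : ¬ DivBy p (u 0)
    p∤u₀ = subst (λ j → ¬ DivBy p (α j)) (sym (+-identityʳ k)) p∤αₖ
    0<δ : 0 < δ
    0<δ = m<n⇒0<n∸m (≤∧≢⇒< n≤m n≢m)
    m≡n+δ : m ≡ n + δ
    m≡n+δ = sym (m+[n∸m]≡n n≤m)
    shifted : tpow (p * k + n) ⊛ (u ^ᴾ p ⊛ (one ⊖ tpow δ)) ≈ tpow (n + m) ⊛ (one ⊖ tpow (q * k) ⊛ u ^ᴾ q)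
    shifted = Equivalence.to (equation⇔ m≡n+δ (≈-sym (tpow-⊛-drop-≈ α k below))) equation
    by-comparison : Tri (p * k < m) (p * k ≡ m) (m < p * k) → n ∣[ p ] m
    by-comparison (tri< pk<m _ _) = contradiction pk<m (¬pk<m u p∤u₀ 0<δ m≡n+δ shifted)
    by-comparison (tri≈ _ pk≡m _) = pk≡m⇒n∣ₚm u p∤u₀ 0<δ m≡n+δ shifted pk≡m
    by-comparison (tri> _ _ m<pk) = contradiction m<pk (¬m<pk u p∤u₀ 0<δ m≡n+δ shifted)

  reverse : ∀ {α} → Witness n m α → n ∣[ p ] m
  reverse {α} (equation , nonvanishing) with least-counterexample (λ i → + p ℤ∣.∣? α i) N
  ... | inj₁ all-divisible = contradiction (≈-trans (^ᴾ-cong (3 * p) α≈0) (≗⇒≈ (zero-^ᴾ (3 * p)))) nonvanishing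
    where
    α≈0 : α ≈ zeroP
    α≈0 = mk≈ λ i i<N → subst (DivBy p) (sym (ℤ.+-identityʳ (α i))) (all-divisible i i<N)
  ... | inj₂ (k , _ , p∤αₖ , below) with n ≟ m
  ...   | yes refl = 0 , sym (+-identityʳ n)
  ...   | no n≢m   = ∣ₚ-from-valuation k equation p∤αₖ below n≢m

lemma3p3 : (p n m N : ℕ) → Prime p → 0 < n → n ≤ m → 3 * m < N →
    (n ∣[ p ] m) ⇔
    (∃ λ (α : Poly) →
      Eq p N (α ^ᴾ p ⊛ (tpow n ⊖ tpow m)) (tpow n ⊛ tpow m ⊛ (one ⊖ α ^ᴾ (p ∸ 1)))
      × ¬ Eq p N (α ^ᴾ (3 * p)) zeroP)
lemma3p3 zero    n m N () 0<n n≤m 3m<N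
lemma3p3 (suc q) n m N p-prime 0<n n≤m 3m<N = mk⇔
  (λ n∣ₚm → let (α , equation , nonvanishing) = Forward.forward q N p-prime 0<n n∣ₚm 3m<N
            in α , ≈⇒Eq equation , nonvanishing ∘ Eq⇒≈)
  (λ (α , equation , nonvanishing) → Reverse.reverse q N p-prime 0<n n≤m 3m<N (Eq⇒≈ equation , nonvanishing ∘ ≈⇒Eq))
  where open Quotient (suc q) N using (Eq⇒≈; ≈⇒Eq)
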